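{- Let $q,u,v,x,y$ be indeterminates (generic parameters). For integers $r,s$ define $\mathcal M^{(u,v;x,y)}_{r,s}=0$ unless $r-s=2i$ with $i\ge 0$ an integer, in which case $$\mathcal M^{(u,v;x,y)}_{r,r-2i}=y^iv^i\,\frac{(x/y;q)_i}{(q;q)_i}\,\frac{(uq^{r-2i};q)_{2i}}{(uxq^{r-i};q)_i\,(uyq^{r-2i+1};q)_i}.$$ Then the infinite lower-triangular matrices $\mathcal M(u,v;x,y)=(\mathcal M^{(u,v;x,y)}_{r,s})_{r,s\in\mathbb Z}$ and $\mathcal M(u,v;y,x)$ are mutually inverse, i.e. $\sum_{r\ge s\ge p}\mathcal M^{(u,v;x,y)}_{r,s}\mathcal M^{(u,v;y,x)}_{s,p}=\delta_{rp}$ for all integers $r\ge p$.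
   Context: For an indeterminate $a$ and integer $k\ge 0$, $(a;q)_k=\prod_{j=0}^{k-1}(1-aq^j)$. A matrix $(f_{ij})_{i,j\in\mathbb Z}$ is lower-triangular if $f_{ij}=0$ unless $i\ge j$; two such matrices $(f_{ij})$, $(g_{kl})$ are mutually inverse if $\sum_{i\ge j\ge k}f_{ij}g_{jk}=\delta_{ik}$ for all $i,k$. -}

module Defs where

open import Level using (Level; _⊔_)
open import Algebra.Bundles using (CommutativeRing)
open import Relation.Nullary using (¬_; yes; no)
open import Data.Nat as ℕ using (ℕ; zero; suc)
open import Data.Integer as ℤ using (ℤ; +_; -[1+_])
open import Data.Maybe using (Maybe; just; nothing)

-- A field: a commutative ring with 1 ≉ 0 and multiplicative inverses of
-- nonzero elements (the inverse function is total; its value at 0 is junk).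
record Field (c ℓ : Level) : Set (Level.suc (c ⊔ ℓ)) where
  field
    commutativeRing : CommutativeRing c ℓ
  open CommutativeRing commutativeRing public
  field
    _⁻¹      : Carrier → Carrier
    inverseʳ : ∀ a → ¬ (a ≈ 0#) → (a * (a ⁻¹)) ≈ 1#
    1≉0      : ¬ (1# ≈ 0#)

half : ℕ → Maybe ℕ
half zero = just zero
half (suc zero) = nothing
half (suc (suc n)) with half n
... | just i = just (suc i)
... | nothing = nothing

module FieldOps {c ℓ : Level} (F : Field c ℓ) where
  open Field F hiding (zero)

  _^_ : Carrier → ℕ → Carrier
  a ^ zero = 1#
  a ^ suc n = a * (a ^ n)

  _^ᶻ_ : Carrier → ℤ → Carrier
  a ^ᶻ (+ n) = a ^ n
  a ^ᶻ -[1+ n ] = (a ⁻¹) ^ suc n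

  poch : Carrier → Carrier → ℕ → Carrier
  poch a q zero = 1#
  poch a q (suc k) = poch a q k * (1# - (a * (q ^ k)))

  entry : (q u v x y : Carrier) → ℤ → ℕ → Carrier
  entry q u v x y r i =
    ((y ^ i) * (v ^ i))
    * ((poch (x * (y ⁻¹)) q i * (poch q q i) ⁻¹)
    * (poch (u * (q ^ᶻ (r ℤ.- + (2 ℕ.* i)))) q (2 ℕ.* i)
       * (poch (u * (x * (q ^ᶻ (r ℤ.- + i)))) q i
          * poch (u * (y * (q ^ᶻ ((r ℤ.- + (2 ℕ.* i)) ℤ.+ + 1)))) q i) ⁻¹))

  M : (q u v x y : Carrier) → ℤ → ℤ → Carrier
  M q u v x y r s with r ℤ.- s
  ... | -[1+ _ ] = 0#
  ... | + n with half n
  ...   | just i = entry q u v x y r i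
  ...   | nothing = 0#

  sumTo : ℕ → (ℕ → Carrier) → Carrier
  sumTo zero f = f zero
  sumTo (suc n) f = sumTo n f + f (suc n)

  sumFromTo : ℤ → ℤ → (ℤ → Carrier) → Carrier
  sumFromTo p r f = sumTo ℤ.∣ r ℤ.- p ∣ (λ k → f (p ℤ.+ + k))

  δ : ℤ → ℤ → Carrier
  δ r p with r ℤ.≟ p
  ... | yes _ = 1#
  ... | no _ = 0#

{-# OPTIONS --safe #-}

-- Write a = u q^p. Entries of M(u,v;x,y) whose row and column differ by an odd number vanish,
-- and for r = p + 2n, s = p + 2j the product M^(x,y)_(r,s) M^(y,x)_(s,p) equals
-- v^n (a;q)_2n t(j, n-j) for a term t that no longer involves u, v or p. So it suffices that
-- the sum of t(j, n-j) over 0 ≤ j ≤ n vanishes for n ≥ 1. This sum telescopes: for k ≥ 1 the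
-- partial sums of t(j, m+k-j) over j ≤ m have a closed form G(m,k), because
-- G(m,k+1) + t(m+1,k) = G(m+1,k), which after removing a common hypergeometric factor is a
-- polynomial identity; and G(m,0) = 0 thanks to the factor 1 - q^k of G(m,k).

module Submission where

open import Defs
open import Level using (Level)
open import Relation.Nullary using (¬_)
open import Data.Nat using (ℕ; NonZero)
open import Data.Integer using (ℤ; _≤_; +_)
open import Algebra.Bundles using (CommutativeRing)
open import Data.Nat as ℕ using (zero; suc; _∸_; z≤n; s≤s)
import Data.Nat.Properties as ℕ
open import Data.Nat.Tactic.RingSolver using (solve-∀)
open import Data.Integer as ℤ using (-[1+_]; 0ℤ; 1ℤ; _⊖_; sign; ∣_∣; _◃_)
import Data.Integer.Properties as ℤ
import Data.Integer.Tactic.RingSolver as ℤ-Solver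
open import Data.Sign as Sign using (Sign)
open import Data.Maybe using (just; nothing; map)
open import Data.Empty using (⊥-elim)
open import Relation.Nullary using (yes; no)
open import Relation.Nullary.Decidable using (dec⇒maybe)
import Relation.Binary.PropositionalEquality as ≡
open ≡ using (_≡_; _≢_)

module ℤ-CoefficientSolver {c ℓ} (R : CommutativeRing c ℓ) where
  open CommutativeRing R
  open import Algebra.Properties.Semiring.Mult.TCOptimised semiring
    using (_×_; 1+×; ×-homo-+; ×1-homo-*)
  open import Algebra.Properties.Ring ring
    using (-0#≈0#; -‿involutive; -‿+-comm; -‿distribˡ-*; -‿distribʳ-*)
  open import Algebra.Properties.CommutativeSemigroup +-commutativeSemigroup
    using (interchange)
  open import Algebra.Solver.Ring.AlmostCommutativeRing
    using (fromCommutativeRing; _-Raw-AlmostCommutative⟶_)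
  open import Relation.Binary.Reasoning.Setoid setoid

  -- The optimised _×_ makes ⟦ + 1 ⟧ reduce to 1#, so that solve applies to goals stated with 1#.
  ⟦_⟧ : ℤ → Carrier
  ⟦ + n ⟧ = n × 1#
  ⟦ -[1+ n ] ⟧ = - (suc n × 1#)

  [1+x]-[1+y]≈x-y : ∀ x y → (1# + x) - (1# + y) ≈ x - y
  [1+x]-[1+y]≈x-y x y = begin
    (1# + x) + - (1# + y)   ≈⟨ +-congˡ (-‿+-comm 1# y) ⟨
    (1# + x) + (- 1# + - y) ≈⟨ interchange 1# x (- 1#) (- y) ⟩
    (1# - 1#) + (x - y)     ≈⟨ +-congʳ (-‿inverseʳ 1#) ⟩
    0# + (x - y)            ≈⟨ +-identityˡ (x - y) ⟩
    x - y                   ∎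

  ⟦⊖⟧ : ∀ m n → ⟦ m ⊖ n ⟧ ≈ m × 1# - n × 1#
  ⟦⊖⟧ m zero = begin
    ⟦ m ⊖ 0 ⟧    ≡⟨ ≡.cong ⟦_⟧ (ℤ.⊖-≥ {m} ℕ.z≤n) ⟩
    m × 1#       ≈⟨ +-identityʳ (m × 1#) ⟨
    m × 1# + 0#  ≈⟨ +-congˡ -0#≈0# ⟨
    m × 1# - 0#  ∎
  ⟦⊖⟧ zero (suc n) = begin
    ⟦ 0 ⊖ suc n ⟧      ≡⟨ ≡.cong ⟦_⟧ (ℤ.⊖-< {0} {suc n} (ℕ.s≤s ℕ.z≤n)) ⟩
    - (suc n × 1#)     ≈⟨ +-identityˡ _ ⟨
    0# - (suc n × 1#)  ∎
  ⟦⊖⟧ (suc m) (suc n) = begin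
    ⟦ suc m ⊖ suc n ⟧                  ≡⟨ ≡.cong ⟦_⟧ (ℤ.[1+m]⊖[1+n]≡m⊖n m n) ⟩
    ⟦ m ⊖ n ⟧                          ≈⟨ ⟦⊖⟧ m n ⟩
    m × 1# - n × 1#                    ≈⟨ [1+x]-[1+y]≈x-y (m × 1#) (n × 1#) ⟨
    (1# + m × 1#) - (1# + n × 1#)      ≈⟨ +-cong (1+× m 1#) (-‿cong (1+× n 1#)) ⟨
    suc m × 1# - suc n × 1#            ∎

  ⟦⟧-homo-+ : ∀ i j → ⟦ i ℤ.+ j ⟧ ≈ ⟦ i ⟧ + ⟦ j ⟧
  ⟦⟧-homo-+ (+ m) (+ n) = ×-homo-+ 1# m n
  ⟦⟧-homo-+ (+ m) -[1+ n ] = ⟦⊖⟧ m (suc n)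
  ⟦⟧-homo-+ -[1+ m ] (+ n) = trans (⟦⊖⟧ n (suc m)) (+-comm _ _)
  ⟦⟧-homo-+ -[1+ m ] -[1+ n ] = begin
    - (suc (suc (m ℕ.+ n)) × 1#)       ≡⟨ ≡.cong (λ k → - (suc k × 1#)) (ℕ.+-suc m n) ⟨
    - ((suc m ℕ.+ suc n) × 1#)         ≈⟨ -‿cong (×-homo-+ 1# (suc m) (suc n)) ⟩
    - (suc m × 1# + suc n × 1#)        ≈⟨ -‿+-comm _ _ ⟨
    - (suc m × 1#) + - (suc n × 1#)    ∎

  signed : Sign → Carrier → Carrier
  signed Sign.+ x = x
  signed Sign.- x = - x

  ⟦⟧-signed : ∀ i → ⟦ i ⟧ ≈ signed (sign i) (∣ i ∣ × 1#)
  ⟦⟧-signed (+ n) = refl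
  ⟦⟧-signed -[1+ n ] = refl

  ⟦◃⟧ : ∀ s n → ⟦ s ◃ n ⟧ ≈ signed s (n × 1#)
  ⟦◃⟧ Sign.+ zero = refl
  ⟦◃⟧ Sign.- zero = sym -0#≈0#
  ⟦◃⟧ Sign.+ (suc n) = refl
  ⟦◃⟧ Sign.- (suc n) = refl

  signed-cong : ∀ s {x y} → x ≈ y → signed s x ≈ signed s y
  signed-cong Sign.+ x≈y = x≈y
  signed-cong Sign.- x≈y = -‿cong x≈y

  signed-homo-* : ∀ s t x y → signed (s Sign.* t) (x * y) ≈ signed s x * signed t y
  signed-homo-* Sign.+ Sign.+ x y = refl
  signed-homo-* Sign.+ Sign.- x y = -‿distribʳ-* x y
  signed-homo-* Sign.- Sign.+ x y = -‿distribˡ-* x y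
  signed-homo-* Sign.- Sign.- x y = begin
    x * y         ≈⟨ -‿involutive (x * y) ⟨
    - - (x * y)   ≈⟨ -‿cong (-‿distribˡ-* x y) ⟩
    - (- x * y)   ≈⟨ -‿distribʳ-* (- x) y ⟩
    - x * - y     ∎

  ⟦⟧-homo-* : ∀ i j → ⟦ i ℤ.* j ⟧ ≈ ⟦ i ⟧ * ⟦ j ⟧
  ⟦⟧-homo-* i j = begin
    ⟦ (sign i Sign.* sign j) ◃ (∣ i ∣ ℕ.* ∣ j ∣) ⟧
      ≈⟨ ⟦◃⟧ (sign i Sign.* sign j) (∣ i ∣ ℕ.* ∣ j ∣) ⟩
    signed (sign i Sign.* sign j) ((∣ i ∣ ℕ.* ∣ j ∣) × 1#)
      ≈⟨ signed-cong (sign i Sign.* sign j) (×1-homo-* ∣ i ∣ ∣ j ∣) ⟩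
    signed (sign i Sign.* sign j) (∣ i ∣ × 1# * ∣ j ∣ × 1#)
      ≈⟨ signed-homo-* (sign i) (sign j) _ _ ⟩
    signed (sign i) (∣ i ∣ × 1#) * signed (sign j) (∣ j ∣ × 1#)
      ≈⟨ *-cong (⟦⟧-signed i) (⟦⟧-signed j) ⟨
    ⟦ i ⟧ * ⟦ j ⟧                                              ∎

  ⟦⟧-homo-‿ : ∀ i → ⟦ ℤ.- i ⟧ ≈ - ⟦ i ⟧
  ⟦⟧-homo-‿ (+ zero) = sym -0#≈0#
  ⟦⟧-homo-‿ (+ suc n) = refl
  ⟦⟧-homo-‿ -[1+ n ] = sym (-‿involutive _)

  morphism : ℤ.+-*-rawRing -Raw-AlmostCommutative⟶ fromCommutativeRing R
  morphism = record
    { ⟦_⟧    = ⟦_⟧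
    ; +-homo = ⟦⟧-homo-+
    ; *-homo = ⟦⟧-homo-*
    ; -‿homo = ⟦⟧-homo-‿
    ; 0-homo = refl
    ; 1-homo = refl
    }

  open import Algebra.Solver.Ring ℤ.+-*-rawRing (fromCommutativeRing R) morphism
    (λ i j → map (λ i≡j → reflexive (≡.cong ⟦_⟧ i≡j)) (dec⇒maybe (i ℤ.≟ j)))
    public using (solve; _:=_; con; _:+_; _:*_; _:-_)

module FieldProperties {c ℓ} (F : Field c ℓ) where
  open Field F
  open ℤ-CoefficientSolver commutativeRing
  open import Relation.Binary.Reasoning.Setoid setoid

  infixl 7 _/_
  _/_ : Carrier → Carrier → Carrier
  n / d = n * d ⁻¹

  ≉0-resp-≈ : ∀ {a b} → a ≈ b → a ≉ 0# → b ≉ 0#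
  ≉0-resp-≈ a≈b a≉0 b≈0 = a≉0 (trans a≈b b≈0)

  1-‿cong : ∀ {a b} → a ≈ b → 1# - a ≈ 1# - b
  1-‿cong a≈b = +-congˡ (-‿cong a≈b)

  ⁻¹-inverseˡ : ∀ {a} → a ≉ 0# → a ⁻¹ * a ≈ 1#
  ⁻¹-inverseˡ {a} a≉0 = trans (*-comm (a ⁻¹) a) (inverseʳ a a≉0)

  *-≉0 : ∀ {a b} → a ≉ 0# → b ≉ 0# → a * b ≉ 0#
  *-≉0 {a} {b} a≉0 b≉0 ab≈0 = b≉0 (begin
    b                ≈⟨ *-identityˡ b ⟨
    1# * b           ≈⟨ *-congʳ (⁻¹-inverseˡ a≉0) ⟨
    (a ⁻¹ * a) * b   ≈⟨ *-assoc (a ⁻¹) a b ⟩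
    a ⁻¹ * (a * b)   ≈⟨ *-congˡ ab≈0 ⟩
    a ⁻¹ * 0#        ≈⟨ zeroʳ (a ⁻¹) ⟩
    0#               ∎)

  ⁻¹-unique : ∀ {a b} → a ≉ 0# → a * b ≈ 1# → a ⁻¹ ≈ b
  ⁻¹-unique {a} {b} a≉0 ab≈1 = begin
    a ⁻¹              ≈⟨ *-identityʳ (a ⁻¹) ⟨
    a ⁻¹ * 1#         ≈⟨ *-congˡ ab≈1 ⟨
    a ⁻¹ * (a * b)    ≈⟨ *-assoc (a ⁻¹) a b ⟨
    (a ⁻¹ * a) * b    ≈⟨ *-congʳ (⁻¹-inverseˡ a≉0) ⟩
    1# * b            ≈⟨ *-identityˡ b ⟩
    b                 ∎

  ⁻¹-cong : ∀ {a b} → a ≉ 0# → a ≈ b → a ⁻¹ ≈ b ⁻¹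
  ⁻¹-cong {a} a≉0 a≈b =
    sym (⁻¹-unique (≉0-resp-≈ a≈b a≉0) (trans (*-congʳ (sym a≈b)) (inverseʳ a a≉0)))

  ⁻¹-distrib-* : ∀ {a b} → a ≉ 0# → b ≉ 0# → (a * b) ⁻¹ ≈ a ⁻¹ * b ⁻¹
  ⁻¹-distrib-* {a} {b} a≉0 b≉0 = ⁻¹-unique (*-≉0 a≉0 b≉0) (begin
    (a * b) * (a ⁻¹ * b ⁻¹)     ≈⟨ solve 4 (λ a b a' b' → (a :* b) :* (a' :* b') := (a :* a') :* (b :* b'))
                                         refl a b (a ⁻¹) (b ⁻¹) ⟩
    (a * a ⁻¹) * (b * b ⁻¹)     ≈⟨ *-cong (inverseʳ a a≉0) (inverseʳ b b≉0) ⟩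
    1# * 1#                     ≈⟨ *-identityˡ 1# ⟩
    1#                          ∎)

  1⁻¹≈1 : 1# ⁻¹ ≈ 1#
  1⁻¹≈1 = ⁻¹-unique 1≉0 (*-identityˡ 1#)

  /-cong : ∀ {n n′ d d′} → d ≉ 0# → n ≈ n′ → d ≈ d′ → n / d ≈ n′ / d′
  /-cong d≉0 n≈n′ d≈d′ = *-cong n≈n′ (⁻¹-cong d≉0 d≈d′)

  /-*-/ : ∀ {n₁ n₂ d₁ d₂} → d₁ ≉ 0# → d₂ ≉ 0# → (n₁ / d₁) * (n₂ / d₂) ≈ (n₁ * n₂) / (d₁ * d₂)
  /-*-/ {n₁} {n₂} {d₁} {d₂} d₁≉0 d₂≉0 = begin
    (n₁ * d₁ ⁻¹) * (n₂ * d₂ ⁻¹)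
      ≈⟨ solve 4 (λ n₁ d₁ n₂ d₂ → (n₁ :* d₁) :* (n₂ :* d₂) := (n₁ :* n₂) :* (d₁ :* d₂))
                 refl n₁ (d₁ ⁻¹) n₂ (d₂ ⁻¹) ⟩
    (n₁ * n₂) * (d₁ ⁻¹ * d₂ ⁻¹)   ≈⟨ *-congˡ (⁻¹-distrib-* d₁≉0 d₂≉0) ⟨
    (n₁ * n₂) / (d₁ * d₂)        ∎

  /-cancelʳ : ∀ {n d w} → d ≉ 0# → w ≉ 0# → (n * w) / (d * w) ≈ n / d
  /-cancelʳ {n} {d} {w} d≉0 w≉0 = begin
    (n * w) / (d * w)    ≈⟨ /-*-/ d≉0 w≉0 ⟨
    (n / d) * (w / w)    ≈⟨ *-congˡ (inverseʳ w w≉0) ⟩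
    (n / d) * 1#         ≈⟨ *-identityʳ (n / d) ⟩
    n / d                ∎

  /-+-/-common : ∀ {n₁ n₂ n₃ d₁ d₂ d₃ w₁ w₂ w₃ D} → D ≉ 0# →
                 d₁ * w₁ ≈ D → d₂ * w₂ ≈ D → d₃ * w₃ ≈ D → n₁ * w₁ + n₂ * w₂ ≈ n₃ * w₃ →
                 n₁ / d₁ + n₂ / d₂ ≈ n₃ / d₃
  /-+-/-common {n₁} {n₂} {n₃} {d₁} {d₂} {d₃} {w₁} {w₂} {w₃} {D} D≉0 e₁ e₂ e₃ e = begin
    n₁ / d₁ + n₂ / d₂                 ≈⟨ +-cong (expand e₁) (expand e₂) ⟩
    (n₁ * w₁) / D + (n₂ * w₂) / D     ≈⟨ distribʳ (D ⁻¹) (n₁ * w₁) (n₂ * w₂) ⟨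
    (n₁ * w₁ + n₂ * w₂) / D           ≈⟨ *-congʳ e ⟩
    (n₃ * w₃) / D                     ≈⟨ expand e₃ ⟨
    n₃ / d₃                           ∎
    where
    expand : ∀ {n d w} → d * w ≈ D → n / d ≈ (n * w) / D
    expand {n} {d} {w} dw≈D = begin
      n / d                ≈⟨ /-cancelʳ d≉0 w≉0 ⟨
      (n * w) / (d * w)    ≈⟨ *-congˡ (⁻¹-cong dw≉0 dw≈D) ⟩
      (n * w) / D          ∎
      where
      dw≉0 : d * w ≉ 0#
      dw≉0 = ≉0-resp-≈ (sym dw≈D) D≉0
      d≉0 : d ≉ 0#
      d≉0 d≈0 = dw≉0 (trans (*-congʳ d≈0) (zeroˡ w))
      w≉0 : w ≉ 0#
      w≉0 w≈0 = dw≉0 (trans (*-congˡ w≈0) (zeroʳ d))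

  /-factor : ∀ {n d P D n′ d′} → D ≉ 0# → d′ ≉ 0# → n ≈ P * n′ → d ≈ D * d′ →
             n / d ≈ (P / D) * (n′ / d′)
  /-factor D≉0 d′≉0 n≈Pn′ d≈Dd′ =
    trans (/-cong (≉0-resp-≈ (sym d≈Dd′) (*-≉0 D≉0 d′≉0)) n≈Pn′ d≈Dd′) (sym (/-*-/ D≉0 d′≉0))

  /-reduce : ∀ {n d n₀ d₀ w} → d₀ ≉ 0# → w ≉ 0# → n ≈ n₀ * w → d ≈ d₀ * w → n / d ≈ n₀ / d₀
  /-reduce d₀≉0 w≉0 n≈n₀w d≈d₀w =
    trans (/-cong (≉0-resp-≈ (sym d≈d₀w) (*-≉0 d₀≉0 w≉0)) n≈n₀w d≈d₀w) (/-cancelʳ d₀≉0 w≉0)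

  x*[1-y/x*z]≈x-y*z : ∀ {x} y z → x ≉ 0# → x * (1# - y / x * z) ≈ x - y * z
  x*[1-y/x*z]≈x-y*z {x} y z x≉0 = begin
    x * (1# - y * x ⁻¹ * z)     ≈⟨ solve 4 (λ x x′ y z → x :* (con (+ 1) :- y :* x′ :* z) := x :- (x :* x′) :* (y :* z))
                                        refl x (x ⁻¹) y z ⟩
    x - (x * x ⁻¹) * (y * z)    ≈⟨ +-congˡ (-‿cong (trans (*-congʳ (inverseʳ x x≉0)) (*-identityˡ (y * z)))) ⟩
    x - y * z                   ∎

  x*[1-y/x]≈x-y : ∀ {x} y → x ≉ 0# → x * (1# - y / x) ≈ x - y
  x*[1-y/x]≈x-y {x} y x≉0 = begin
    x * (1# - y / x)         ≈⟨ *-congˡ (1-‿cong (*-identityʳ (y / x))) ⟨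
    x * (1# - y / x * 1#)    ≈⟨ x*[1-y/x*z]≈x-y*z y 1# x≉0 ⟩
    x - y * 1#               ≈⟨ +-congˡ (-‿cong (*-identityʳ y)) ⟩
    x - y                    ∎

module PowerProperties {c ℓ} (F : Field c ℓ) where
  open Field F hiding (zero)
  open FieldOps F
  open FieldProperties F
  open ℤ-CoefficientSolver commutativeRing
  open import Relation.Binary.Reasoning.Setoid setoid

  ^-homo-* : ∀ b m n → b ^ (m ℕ.+ n) ≈ b ^ m * b ^ n
  ^-homo-* b zero n = sym (*-identityˡ (b ^ n))
  ^-homo-* b (suc m) n = trans (*-congˡ (^-homo-* b m n)) (sym (*-assoc b (b ^ m) (b ^ n)))

  ^-cong-≡ : ∀ b {m n} → m ≡ n → b ^ m ≈ b ^ n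
  ^-cong-≡ b m≡n = reflexive (≡.cong (b ^_) m≡n)

  *-^-homo-* : ∀ x b m n → x * b ^ m * b ^ n ≈ x * b ^ (m ℕ.+ n)
  *-^-homo-* x b m n = trans (*-assoc x (b ^ m) (b ^ n)) (*-congˡ (sym (^-homo-* b m n)))

  module _ {q : Carrier} (q≉0 : q ≉ 0#) where

    ^ᶻ-suc : ∀ z → q ^ᶻ (z ℤ.+ + 1) ≈ q ^ᶻ z * q
    ^ᶻ-suc (+ n) = trans (^-homo-* q n 1) (*-congˡ (*-identityʳ q))
    ^ᶻ-suc -[1+ zero ] = sym (begin
      (q ⁻¹ * 1#) * q    ≈⟨ *-congʳ (*-identityʳ (q ⁻¹)) ⟩
      q ⁻¹ * q           ≈⟨ ⁻¹-inverseˡ q≉0 ⟩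
      1#                 ∎)
    ^ᶻ-suc -[1+ suc n ] = sym (begin
      (q ⁻¹ * (q ⁻¹) ^ suc n) * q    ≈⟨ solve 3 (λ q′ r q → (q′ :* r) :* q := r :* (q′ :* q))
                                               refl (q ⁻¹) ((q ⁻¹) ^ suc n) q ⟩
      (q ⁻¹) ^ suc n * (q ⁻¹ * q)    ≈⟨ *-congˡ (⁻¹-inverseˡ q≉0) ⟩
      (q ⁻¹) ^ suc n * 1#            ≈⟨ *-identityʳ _ ⟩
      (q ⁻¹) ^ suc n                 ∎)

    ^ᶻ-homo-* : ∀ z n → q ^ᶻ (z ℤ.+ + n) ≈ q ^ᶻ z * q ^ n
    ^ᶻ-homo-* z zero = trans (reflexive (≡.cong (q ^ᶻ_) (ℤ.+-identityʳ z))) (sym (*-identityʳ _))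
    ^ᶻ-homo-* z (suc n) = begin
      q ^ᶻ (z ℤ.+ + suc n)          ≡⟨ ≡.cong (q ^ᶻ_) (ℤ.+-assoc z (+ 1) (+ n)) ⟨
      q ^ᶻ ((z ℤ.+ + 1) ℤ.+ + n)    ≈⟨ ^ᶻ-homo-* (z ℤ.+ + 1) n ⟩
      q ^ᶻ (z ℤ.+ + 1) * q ^ n      ≈⟨ *-congʳ (^ᶻ-suc z) ⟩
      (q ^ᶻ z * q) * q ^ n          ≈⟨ *-assoc (q ^ᶻ z) q (q ^ n) ⟩
      q ^ᶻ z * q ^ suc n            ∎

module PochhammerProperties {c ℓ} (F : Field c ℓ) (q : Field.Carrier F) where
  open Field F hiding (zero)
  open FieldOps F
  open FieldProperties F
  open PowerProperties F
  open import Relation.Binary.Reasoning.Setoid setoid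

  poch-cong : ∀ {a b} n → a ≈ b → poch a q n ≈ poch b q n
  poch-cong zero a≈b = refl
  poch-cong (suc n) a≈b = *-cong (poch-cong n a≈b) (1-‿cong (*-congʳ a≈b))

  poch-homo-* : ∀ a m n → poch a q (m ℕ.+ n) ≈ poch a q m * poch (a * q ^ m) q n
  poch-homo-* a m zero = begin
    poch a q (m ℕ.+ 0)    ≡⟨ ≡.cong (poch a q) (ℕ.+-identityʳ m) ⟩
    poch a q m            ≈⟨ *-identityʳ _ ⟨
    poch a q m * 1#       ∎
  poch-homo-* a m (suc n) = begin
    poch a q (m ℕ.+ suc n)                                          ≡⟨ ≡.cong (poch a q) (ℕ.+-suc m n) ⟩
    poch a q (m ℕ.+ n) * (1# - a * q ^ (m ℕ.+ n))
      ≈⟨ *-cong (poch-homo-* a m n) (1-‿cong (sym (*-^-homo-* a q m n))) ⟩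
    poch a q m * poch (a * q ^ m) q n * (1# - a * q ^ m * q ^ n)   ≈⟨ *-assoc _ _ _ ⟩
    poch a q m * poch (a * q ^ m) q (suc n)                         ∎

  poch-suc : ∀ a n → poch a q (suc n) ≈ (1# - a) * poch (a * q) q n
  poch-suc a n = begin
    poch a q (1 ℕ.+ n)                        ≈⟨ poch-homo-* a 1 n ⟩
    (1# * (1# - a * 1#)) * poch (a * q ^ 1) q n ≈⟨ *-cong (*-identityˡ _) (poch-cong n (*-congˡ (*-identityʳ q))) ⟩
    (1# - a * 1#) * poch (a * q) q n          ≈⟨ *-congʳ (1-‿cong (*-identityʳ a)) ⟩
    (1# - a) * poch (a * q) q n               ∎

  bqᵉ*q≈bqᶠ : ∀ b e {f} → suc e ≡ f → b * q ^ e * q ≈ b * q ^ f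
  bqᵉ*q≈bqᶠ b e {f} 1+e≡f = begin
    b * q ^ e * q      ≈⟨ *-assoc b (q ^ e) q ⟩
    b * (q ^ e * q)    ≈⟨ *-congˡ (*-comm (q ^ e) q) ⟩
    b * q ^ suc e      ≈⟨ *-congˡ (^-cong-≡ q 1+e≡f) ⟩
    b * q ^ f          ∎

  poch-≉0 : ∀ {a} → (∀ n → 1# - a * q ^ n ≉ 0#) → ∀ n → poch a q n ≉ 0#
  poch-≉0 1-aqⁿ≉0 zero = 1≉0
  poch-≉0 1-aqⁿ≉0 (suc n) = *-≉0 (poch-≉0 1-aqⁿ≉0 n) (1-aqⁿ≉0 n)

  1-bqᵉqⁿ≉0 : ∀ {b} → (∀ n → 1# - b * q ^ n ≉ 0#) → ∀ e n → 1# - b * q ^ e * q ^ n ≉ 0#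
  1-bqᵉqⁿ≉0 {b} 1-bqⁿ≉0 e n =
    ≉0-resp-≈ (1-‿cong (sym (*-^-homo-* b q e n))) (1-bqⁿ≉0 (e ℕ.+ n))

data Halving : ℕ → Set where
  even : ∀ j → Halving (j ℕ.+ j)
  odd  : ∀ j → Halving (suc (j ℕ.+ j))

halving : ∀ n → Halving n
halving zero = even 0
halving (suc n) with halving n
... | even j = odd j
... | odd j = ≡.subst Halving (≡.cong suc (ℕ.+-suc j j)) (even (suc j))

half-even : ∀ j → half (j ℕ.+ j) ≡ just j
half-even zero = ≡.refl
half-even (suc j) rewrite ℕ.+-suc j j | half-even j = ≡.refl

half-odd : ∀ j → half (suc (j ℕ.+ j)) ≡ nothing
half-odd zero = ≡.refl
half-odd (suc j) rewrite ℕ.+-suc j j | half-odd j = ≡.refl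

j+j≤1+n+n⇒j≤n : ∀ j n → j ℕ.+ j ℕ.≤ suc (n ℕ.+ n) → j ℕ.≤ n
j+j≤1+n+n⇒j≤n zero n _ = z≤n
j+j≤1+n+n⇒j≤n (suc j) zero (s≤s j+1+j≤0) rewrite ℕ.+-suc j j with j+1+j≤0
... | ()
j+j≤1+n+n⇒j≤n (suc j) (suc n) (s≤s le) rewrite ℕ.+-suc j j | ℕ.+-suc n n with le
... | s≤s j+j≤1+n+n = s≤s (j+j≤1+n+n⇒j≤n j n j+j≤1+n+n)

module SumProperties {c ℓ} (F : Field c ℓ) where
  open Field F hiding (zero)
  open FieldOps F
  open import Relation.Binary.Reasoning.Setoid setoid

  sumTo-cong : ∀ m {f g : ℕ → Carrier} → (∀ k → k ℕ.≤ m → f k ≈ g k) → sumTo m f ≈ sumTo m g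
  sumTo-cong zero f≈g = f≈g 0 z≤n
  sumTo-cong (suc m) f≈g = +-cong (sumTo-cong m (λ k k≤m → f≈g k (ℕ.m≤n⇒m≤1+n k≤m))) (f≈g (suc m) ℕ.≤-refl)

  sumTo-≈0 : ∀ m {f : ℕ → Carrier} → (∀ k → k ℕ.≤ m → f k ≈ 0#) → sumTo m f ≈ 0#
  sumTo-≈0 zero f≈0 = f≈0 0 z≤n
  sumTo-≈0 (suc m) f≈0 =
    trans (+-cong (sumTo-≈0 m (λ k k≤m → f≈0 k (ℕ.m≤n⇒m≤1+n k≤m))) (f≈0 (suc m) ℕ.≤-refl)) (+-identityʳ 0#)

  sumTo-*-distribˡ : ∀ m c (f : ℕ → Carrier) → sumTo m (λ k → c * f k) ≈ c * sumTo m f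
  sumTo-*-distribˡ zero c f = refl
  sumTo-*-distribˡ (suc m) c f = trans (+-congʳ (sumTo-*-distribˡ m c f)) (sym (distribˡ c _ _))

  sumTo-evens : ∀ n {f : ℕ → Carrier} → (∀ j → j ℕ.< n → f (suc (j ℕ.+ j)) ≈ 0#) →
                sumTo (n ℕ.+ n) f ≈ sumTo n (λ j → f (j ℕ.+ j))
  sumTo-evens zero f-odd≈0 = refl
  sumTo-evens (suc n) {f} f-odd≈0 rewrite ℕ.+-suc n n = begin
    sumTo (n ℕ.+ n) f + f (suc (n ℕ.+ n)) + f (suc (suc (n ℕ.+ n)))
      ≈⟨ +-congʳ (+-cong (sumTo-evens n (λ j j<n → f-odd≈0 j (ℕ.m≤n⇒m≤1+n j<n))) (f-odd≈0 n ℕ.≤-refl)) ⟩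
    sumTo n (λ j → f (j ℕ.+ j)) + 0# + f (suc (suc (n ℕ.+ n)))
      ≈⟨ +-congʳ (+-identityʳ _) ⟩
    sumTo n (λ j → f (j ℕ.+ j)) + f (suc (suc (n ℕ.+ n)))   ∎

  δ-refl : ∀ r → δ r r ≈ 1#
  δ-refl r with r ℤ.≟ r
  ... | yes _ = refl
  ... | no r≢r = ⊥-elim (r≢r ≡.refl)

  δ-≢ : ∀ {r s} → r ≢ s → δ r s ≈ 0#
  δ-≢ {r} {s} r≢s with r ℤ.≟ s
  ... | yes r≡s = ⊥-elim (r≢s r≡s)
  ... | no _ = refl

z+a-z≡a : ∀ z a → z ℤ.+ a ℤ.- z ≡ a
z+a-z≡a = ℤ-Solver.solve-∀

z+[a+b]-[z+a]≡b : ∀ z a b → z ℤ.+ (a ℤ.+ b) ℤ.- (z ℤ.+ a) ≡ b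
z+[a+b]-[z+a]≡b = ℤ-Solver.solve-∀

module _ {c ℓ} (R : CommutativeRing c ℓ) where
  open CommutativeRing R
  open ℤ-CoefficientSolver R

  telescoping-identity : ∀ a x y q M K →
    (y - x * K) * ((1# - q * M) * (1# - a * x * q * M) * (1# - a * y * (q * M) * (M * (q * K))))
    + (x - y) * (1# - a * y * (q * M * (q * M))) * ((1# - a * x * (M * (q * K))) * (1# - M * (q * K)))
    ≈ (x - y * (q * M)) * (1# - K) * (1# - a * x * (q * (M * K) * (q * M))) * (1# - a * y * (q * M))
  telescoping-identity = solve 6 (λ a x y q M K →
      let 1-_ = λ e → con (+ 1) :- e in
      (y :- x :* K) :* ((1- (q :* M)) :* (1- (a :* x :* q :* M)) :* (1- (a :* y :* (q :* M) :* (M :* (q :* K)))))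
      :+ (x :- y) :* (1- (a :* y :* (q :* M :* (q :* M)))) :* ((1- (a :* x :* (M :* (q :* K)))) :* (1- (M :* (q :* K))))
      := (x :- y :* (q :* M)) :* (1- K) :* (1- (a :* x :* (q :* (M :* K) :* (q :* M)))) :* (1- (a :* y :* (q :* M))))
    refl

module VanishingSum {c ℓ} (F : Field c ℓ) (a q x y : Field.Carrier F) where
  open Field F hiding (zero)
  open FieldOps F hiding (M)
  open FieldProperties F
  open PowerProperties F
  open PochhammerProperties F q
  open ℤ-CoefficientSolver commutativeRing
  open import Relation.Binary.Reasoning.Setoid setoid

  t : ℕ → ℕ → Carrier
  t j i = y ^ i * x ^ j * poch (x / y) q i * poch (y / x) q j * (1# - a * y * q ^ (j ℕ.+ j))
        / (poch q q i * poch q q j * poch (a * x * q) q j * poch (a * x * q ^ (j ℕ.+ j ℕ.+ i)) q i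
           * poch (a * y * q ^ j) q (j ℕ.+ suc i))

  G : ℕ → ℕ → Carrier
  G m k = y ^ k * x ^ m * poch (x / y) q k * poch (y / x * q) q m * (1# - q ^ k) * (1# - a * x * q ^ (m ℕ.+ k ℕ.+ m))
        / ((1# - a * x * q ^ (m ℕ.+ k)) * (1# - q ^ (m ℕ.+ k)) * poch q q k * poch q q m * poch (a * x * q) q m
           * poch (a * x * q ^ (m ℕ.+ k ℕ.+ m)) q k * poch (a * y * q ^ suc m) q (m ℕ.+ k))

  G-zero : ∀ m → G m 0 ≈ 0#
  G-zero m = trans (*-congʳ (trans (*-congʳ (trans (*-congˡ (-‿inverseʳ 1#)) (zeroʳ _))) (zeroˡ _))) (zeroˡ _)

  module _ (x≉0 : x ≉ 0#) (y≉0 : y ≉ 0#)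
           (1-qⁿ⁺¹≉0 : ∀ n → 1# - q ^ suc n ≉ 0#)
           (1-axqⁿ≉0 : ∀ n → 1# - a * x * q ^ n ≉ 0#)
           (1-ayqⁿ≉0 : ∀ n → 1# - a * y * q ^ n ≉ 0#) where

    [q]≉0 : ∀ n → poch q q n ≉ 0#
    [q]≉0 = poch-≉0 1-qⁿ⁺¹≉0

    [axqᵉ]≉0 : ∀ e n → poch (a * x * q ^ e) q n ≉ 0#
    [axqᵉ]≉0 e = poch-≉0 (1-bqᵉqⁿ≉0 1-axqⁿ≉0 e)

    [ayqᵉ]≉0 : ∀ e n → poch (a * y * q ^ e) q n ≉ 0#
    [ayqᵉ]≉0 e = poch-≉0 (1-bqᵉqⁿ≉0 1-ayqⁿ≉0 e)

    1-axq*qⁿ≉0 : ∀ n → 1# - a * x * q * q ^ n ≉ 0#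
    1-axq*qⁿ≉0 n = ≉0-resp-≈ (1-‿cong (sym (*-assoc (a * x) q (q ^ n)))) (1-axqⁿ≉0 (suc n))

    [axq]≉0 : ∀ n → poch (a * x * q) q n ≉ 0#
    [axq]≉0 = poch-≉0 1-axq*qⁿ≉0

    module Base (k : ℕ) where
      K : ℕ
      K = suc k
      N D 1-qᴷ 1-axqᴷ 1-ay : Carrier
      N = y ^ K * poch (x / y) q K
      D = poch q q K * poch (a * x * q ^ K) q K * poch (a * y * q) q K
      1-qᴷ = 1# - q ^ K
      1-axqᴷ = 1# - a * x * q ^ K
      1-ay = 1# - a * y * 1#

      D≉0 : D ≉ 0#
      D≉0 = *-≉0 (*-≉0 ([q]≉0 K) ([axqᵉ]≉0 K K))
                 (≉0-resp-≈ (poch-cong K (*-congˡ (*-identityʳ q))) ([ayqᵉ]≉0 1 K))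

      G₀≈N/D : G 0 K ≈ N / D
      G₀≈N/D rewrite ℕ.+-identityʳ k = /-reduce D≉0 (*-≉0 (1-qⁿ⁺¹≉0 k) (1-axqⁿ≉0 K)) numerator denominator
        where
        numerator : y ^ K * 1# * poch (x / y) q K * 1# * 1-qᴷ * 1-axqᴷ ≈ N * (1-qᴷ * 1-axqᴷ)
        numerator = solve 4 (λ Y P bQ bX → Y :* con (+ 1) :* P :* con (+ 1) :* bQ :* bX := (Y :* P) :* (bQ :* bX))
                      refl (y ^ K) (poch (x / y) q K) 1-qᴷ 1-axqᴷ
        denominator : 1-axqᴷ * 1-qᴷ * poch q q K * 1# * 1# * poch (a * x * q ^ K) q K * poch (a * y * q ^ 1) q K
                      ≈ D * (1-qᴷ * 1-axqᴷ)
        denominator = begin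
          1-axqᴷ * 1-qᴷ * poch q q K * 1# * 1# * poch (a * x * q ^ K) q K * poch (a * y * q ^ 1) q K
            ≈⟨ *-congˡ (poch-cong K (*-congˡ (*-identityʳ q))) ⟩
          1-axqᴷ * 1-qᴷ * poch q q K * 1# * 1# * poch (a * x * q ^ K) q K * poch (a * y * q) q K
            ≈⟨ solve 5 (λ bX bQ Q X Y → bX :* bQ :* Q :* con (+ 1) :* con (+ 1) :* X :* Y := (Q :* X :* Y) :* (bQ :* bX))
                       refl 1-axqᴷ 1-qᴷ (poch q q K) (poch (a * x * q ^ K) q K) (poch (a * y * q) q K) ⟩
          D * (1-qᴷ * 1-axqᴷ) ∎

      t₀≈N/D : t 0 K ≈ N / D
      t₀≈N/D = /-reduce D≉0 (1-ayqⁿ≉0 0) numerator denominator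
        where
        numerator : y ^ K * 1# * poch (x / y) q K * 1# * 1-ay ≈ N * 1-ay
        numerator = solve 3 (λ Y P b → Y :* con (+ 1) :* P :* con (+ 1) :* b := (Y :* P) :* b)
                      refl (y ^ K) (poch (x / y) q K) 1-ay
        denominator : poch q q K * 1# * 1# * poch (a * x * q ^ K) q K * poch (a * y * 1#) q (suc K) ≈ D * 1-ay
        denominator = begin
          poch q q K * 1# * 1# * poch (a * x * q ^ K) q K * poch (a * y * 1#) q (suc K)
            ≈⟨ *-congˡ (poch-suc (a * y * 1#) K) ⟩
          poch q q K * 1# * 1# * poch (a * x * q ^ K) q K * (1-ay * poch (a * y * 1# * q) q K)
            ≈⟨ *-congˡ (*-congˡ (poch-cong K (*-congʳ (*-identityʳ (a * y))))) ⟩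
          poch q q K * 1# * 1# * poch (a * x * q ^ K) q K * (1-ay * poch (a * y * q) q K)
            ≈⟨ solve 4 (λ Q X b Y → Q :* con (+ 1) :* con (+ 1) :* X :* (b :* Y) := (Q :* X :* Y) :* b)
                       refl (poch q q K) (poch (a * x * q ^ K) q K) 1-ay (poch (a * y * q) q K) ⟩
          D * 1-ay ∎

    G-base : ∀ k → G 0 (suc k) ≈ t 0 (suc k)
    G-base k = trans G₀≈N/D (sym t₀≈N/D)
      where open Base k

    -- 1-…qᵉ stands for 1 - (…) q^e. The binomials that survive into rational-identity are
    -- written in terms of M = q^m and K = q^k, which makes it a polynomial identity.
    module Step (m k : ℕ) where
      M K P [axq²ᵐ⁺ᵏ⁺²]ₖ [ayqᵐ⁺²]ₘ₊ₖ D₀ : Carrier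
      M = q ^ m
      K = q ^ k
      P = y ^ k * x ^ m * poch (x / y) q k * poch (y / x * q) q m
      [axq²ᵐ⁺ᵏ⁺²]ₖ = poch (a * x * q ^ (suc m ℕ.+ k ℕ.+ suc m)) q k
      [ayqᵐ⁺²]ₘ₊ₖ = poch (a * y * q ^ suc (suc m)) q (m ℕ.+ k)
      D₀ = poch q q k * poch q q m * poch (a * x * q) q m * [axq²ᵐ⁺ᵏ⁺²]ₖ * [ayqᵐ⁺²]ₘ₊ₖ

      1-qᵏ⁺¹ 1-axq²ᵐ⁺ᵏ⁺¹ 1-axqᵐ⁺ᵏ⁺¹ 1-qᵐ⁺ᵏ⁺¹ 1-ayqᵐ⁺¹ 1-qᵐ⁺¹ 1-axqᵐ⁺¹ : Carrier
      1-ayq²ᵐ⁺ᵏ⁺² 1-ayq²ᵐ⁺² 1-axq²ᵐ⁺ᵏ⁺² : Carrier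
      1-qᵏ⁺¹ = 1# - q ^ suc k
      1-axq²ᵐ⁺ᵏ⁺¹ = 1# - a * x * q ^ (m ℕ.+ suc k ℕ.+ m)
      1-axqᵐ⁺ᵏ⁺¹ = 1# - a * x * (M * (q * K))
      1-qᵐ⁺ᵏ⁺¹ = 1# - M * (q * K)
      1-ayqᵐ⁺¹ = 1# - a * y * (q * M)
      1-qᵐ⁺¹ = 1# - q * M
      1-axqᵐ⁺¹ = 1# - a * x * q * M
      1-ayq²ᵐ⁺ᵏ⁺² = 1# - a * y * (q * M) * (M * (q * K))
      1-ayq²ᵐ⁺² = 1# - a * y * (q * M * (q * M))
      1-axq²ᵐ⁺ᵏ⁺² = 1# - a * x * (q * (M * K) * (q * M))

      qᵐ⁺ᵏ⁺¹ : q ^ (m ℕ.+ suc k) ≈ M * (q * K)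
      qᵐ⁺ᵏ⁺¹ = ^-homo-* q m (suc k)

      qᵐ⁺¹⁺ᵏ : q ^ (suc m ℕ.+ k) ≈ M * (q * K)
      qᵐ⁺¹⁺ᵏ = trans (^-cong-≡ q (≡.sym (ℕ.+-suc m k))) qᵐ⁺ᵏ⁺¹

      ayqᵐ⁺²qᵐ⁺ᵏ : a * y * q ^ suc (suc m) * q ^ (m ℕ.+ k) ≈ a * y * (q * M) * (M * (q * K))
      ayqᵐ⁺²qᵐ⁺ᵏ = begin
        a * y * q ^ suc (suc m) * q ^ (m ℕ.+ k)   ≈⟨ *-^-homo-* (a * y) q (suc (suc m)) (m ℕ.+ k) ⟩
        a * y * q ^ suc (suc m ℕ.+ (m ℕ.+ k))    ≡⟨ ≡.cong (λ e → a * y * q ^ suc e) (ℕ.+-suc m (m ℕ.+ k)) ⟨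
        a * y * q ^ (suc m ℕ.+ suc (m ℕ.+ k))    ≡⟨ ≡.cong (λ e → a * y * q ^ (suc m ℕ.+ e)) (ℕ.+-suc m k) ⟨
        a * y * q ^ (suc m ℕ.+ (m ℕ.+ suc k))    ≈⟨ *-^-homo-* (a * y) q (suc m) (m ℕ.+ suc k) ⟨
        a * y * (q * M) * q ^ (m ℕ.+ suc k)      ≈⟨ *-congˡ qᵐ⁺ᵏ⁺¹ ⟩
        a * y * (q * M) * (M * (q * K))          ∎

      [ayqᵐ⁺¹]ₘ₊ₖ₊₁-split : poch (a * y * q ^ suc m) q (m ℕ.+ suc k) ≈ 1-ayqᵐ⁺¹ * [ayqᵐ⁺²]ₘ₊ₖ
      [ayqᵐ⁺¹]ₘ₊ₖ₊₁-split = begin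
        poch (a * y * q ^ suc m) q (m ℕ.+ suc k)    ≡⟨ ≡.cong (poch (a * y * q ^ suc m) q) (ℕ.+-suc m k) ⟩
        poch (a * y * q ^ suc m) q (suc (m ℕ.+ k))  ≈⟨ poch-suc (a * y * q ^ suc m) (m ℕ.+ k) ⟩
        1-ayqᵐ⁺¹ * poch (a * y * q ^ suc m * q) q (m ℕ.+ k)
          ≈⟨ *-congˡ (poch-cong (m ℕ.+ k) (bqᵉ*q≈bqᶠ (a * y) (suc m) ≡.refl)) ⟩
        1-ayqᵐ⁺¹ * [ayqᵐ⁺²]ₘ₊ₖ                       ∎

      1-axqᵐ⁺ᵏ⁺¹≉0 : 1-axqᵐ⁺ᵏ⁺¹ ≉ 0#
      1-axqᵐ⁺ᵏ⁺¹≉0 = ≉0-resp-≈ (1-‿cong (*-congˡ qᵐ⁺ᵏ⁺¹)) (1-axqⁿ≉0 (m ℕ.+ suc k))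

      1-qᵐ⁺ᵏ⁺¹≉0 : 1-qᵐ⁺ᵏ⁺¹ ≉ 0#
      1-qᵐ⁺ᵏ⁺¹≉0 = ≉0-resp-≈ (1-‿cong qᵐ⁺¹⁺ᵏ) (1-qⁿ⁺¹≉0 (m ℕ.+ k))

      1-ayq²ᵐ⁺ᵏ⁺²≉0 : 1-ayq²ᵐ⁺ᵏ⁺² ≉ 0#
      1-ayq²ᵐ⁺ᵏ⁺²≉0 = ≉0-resp-≈ (1-‿cong ayqᵐ⁺²qᵐ⁺ᵏ) (1-bqᵉqⁿ≉0 1-ayqⁿ≉0 (suc (suc m)) (m ℕ.+ k))

      1-ayqᵐ⁺¹≉0 : 1-ayqᵐ⁺¹ ≉ 0#
      1-ayqᵐ⁺¹≉0 = 1-ayqⁿ≉0 (suc m)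

      1-qᵐ⁺¹≉0 : 1-qᵐ⁺¹ ≉ 0#
      1-qᵐ⁺¹≉0 = 1-qⁿ⁺¹≉0 m

      1-axqᵐ⁺¹≉0 : 1-axqᵐ⁺¹ ≉ 0#
      1-axqᵐ⁺¹≉0 = 1-axq*qⁿ≉0 m

      D₀≉0 : D₀ ≉ 0#
      D₀≉0 = *-≉0 (*-≉0 (*-≉0 (*-≉0 ([q]≉0 k) ([q]≉0 m)) ([axq]≉0 m))
                    ([axqᵉ]≉0 (suc m ℕ.+ k ℕ.+ suc m) k)) ([ayqᵉ]≉0 (suc (suc m)) (m ℕ.+ k))

      ρ-left ρ-mid ρ-right : Carrier
      ρ-left = (y - x * K) / (1-axqᵐ⁺ᵏ⁺¹ * 1-qᵐ⁺ᵏ⁺¹ * 1-ayqᵐ⁺¹)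
      ρ-mid = (x - y) * 1-ayq²ᵐ⁺² / (1-qᵐ⁺¹ * 1-axqᵐ⁺¹ * 1-ayqᵐ⁺¹ * 1-ayq²ᵐ⁺ᵏ⁺²)
      ρ-right = (x - y * (q * M)) * (1# - K) * 1-axq²ᵐ⁺ᵏ⁺²
                / (1-axqᵐ⁺ᵏ⁺¹ * 1-qᵐ⁺ᵏ⁺¹ * 1-qᵐ⁺¹ * 1-axqᵐ⁺¹ * 1-ayq²ᵐ⁺ᵏ⁺²)

      G-left : G m (suc k) ≈ (P / D₀) * ρ-left
      G-left = trans (/-factor D₀≉0 (*-≉0 d≉0 w≉0) numerator denominator) (*-congˡ (/-cancelʳ d≉0 w≉0))
        where
        d w : Carrier
        d = 1-axqᵐ⁺ᵏ⁺¹ * 1-qᵐ⁺ᵏ⁺¹ * 1-ayqᵐ⁺¹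
        w = 1-qᵏ⁺¹ * 1-axq²ᵐ⁺ᵏ⁺¹
        d≉0 : d ≉ 0#
        d≉0 = *-≉0 (*-≉0 1-axqᵐ⁺ᵏ⁺¹≉0 1-qᵐ⁺ᵏ⁺¹≉0) 1-ayqᵐ⁺¹≉0
        w≉0 : w ≉ 0#
        w≉0 = *-≉0 (1-qⁿ⁺¹≉0 k) (1-axqⁿ≉0 (m ℕ.+ suc k ℕ.+ m))
        numerator : y ^ suc k * x ^ m * poch (x / y) q (suc k) * poch (y / x * q) q m * 1-qᵏ⁺¹ * 1-axq²ᵐ⁺ᵏ⁺¹
                    ≈ P * ((y - x * K) * w)
        numerator = begin
          y * y ^ k * x ^ m * (poch (x / y) q k * (1# - x / y * K)) * poch (y / x * q) q m * 1-qᵏ⁺¹ * 1-axq²ᵐ⁺ᵏ⁺¹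
            ≈⟨ solve 8 (λ y yᵏ xᵐ X b B c e → y :* yᵏ :* xᵐ :* (X :* b) :* B :* c :* e
                                          := yᵏ :* xᵐ :* X :* B :* ((y :* b) :* (c :* e)))
                       refl y (y ^ k) (x ^ m) (poch (x / y) q k) (1# - x / y * K) (poch (y / x * q) q m) 1-qᵏ⁺¹ 1-axq²ᵐ⁺ᵏ⁺¹ ⟩
          P * ((y * (1# - x / y * K)) * w)   ≈⟨ *-congˡ (*-congʳ (x*[1-y/x*z]≈x-y*z x K y≉0)) ⟩
          P * ((y - x * K) * w)              ∎
        denominator : (1# - a * x * q ^ (m ℕ.+ suc k)) * (1# - q ^ (m ℕ.+ suc k)) * poch q q (suc k) * poch q q m
                      * poch (a * x * q) q m * poch (a * x * q ^ (m ℕ.+ suc k ℕ.+ m)) q (suc k)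
                      * poch (a * y * q ^ suc m) q (m ℕ.+ suc k)
                      ≈ D₀ * (d * w)
        denominator = begin
          (1# - a * x * q ^ (m ℕ.+ suc k)) * (1# - q ^ (m ℕ.+ suc k)) * (poch q q k * 1-qᵏ⁺¹) * poch q q m
            * poch (a * x * q) q m * poch (a * x * q ^ (m ℕ.+ suc k ℕ.+ m)) q (suc k)
            * poch (a * y * q ^ suc m) q (m ℕ.+ suc k)
            ≈⟨ *-cong (*-cong (*-congʳ (*-congʳ (*-congʳ (*-cong (1-‿cong (*-congˡ qᵐ⁺ᵏ⁺¹)) (1-‿cong qᵐ⁺ᵏ⁺¹)))))
                              [axq²ᵐ⁺ᵏ⁺¹]ₖ₊₁-split)
                      [ayqᵐ⁺¹]ₘ₊ₖ₊₁-split ⟩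
          1-axqᵐ⁺ᵏ⁺¹ * 1-qᵐ⁺ᵏ⁺¹ * (poch q q k * 1-qᵏ⁺¹) * poch q q m * poch (a * x * q) q m
            * (1-axq²ᵐ⁺ᵏ⁺¹ * [axq²ᵐ⁺ᵏ⁺²]ₖ) * (1-ayqᵐ⁺¹ * [ayqᵐ⁺²]ₘ₊ₖ)
            ≈⟨ solve 10 (λ bX bQ Qk bK Qm Xm bZ Xk bY Y →
                           bX :* bQ :* (Qk :* bK) :* Qm :* Xm :* (bZ :* Xk) :* (bY :* Y)
                           := (Qk :* Qm :* Xm :* Xk :* Y) :* ((bX :* bQ :* bY) :* (bK :* bZ)))
                       refl 1-axqᵐ⁺ᵏ⁺¹ 1-qᵐ⁺ᵏ⁺¹ (poch q q k) 1-qᵏ⁺¹ (poch q q m) (poch (a * x * q) q m)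
                            1-axq²ᵐ⁺ᵏ⁺¹ [axq²ᵐ⁺ᵏ⁺²]ₖ 1-ayqᵐ⁺¹ [ayqᵐ⁺²]ₘ₊ₖ ⟩
          D₀ * (d * w) ∎
          where
          [axq²ᵐ⁺ᵏ⁺¹]ₖ₊₁-split : poch (a * x * q ^ (m ℕ.+ suc k ℕ.+ m)) q (suc k) ≈ 1-axq²ᵐ⁺ᵏ⁺¹ * [axq²ᵐ⁺ᵏ⁺²]ₖ
          [axq²ᵐ⁺ᵏ⁺¹]ₖ₊₁-split =
            trans (poch-suc _ k) (*-congˡ (poch-cong k (bqᵉ*q≈bqᶠ (a * x) (m ℕ.+ suc k ℕ.+ m) (exponent m k))))
            where
            exponent : ∀ m k → suc (m ℕ.+ suc k ℕ.+ m) ≡ suc m ℕ.+ k ℕ.+ suc m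
            exponent = solve-∀

      t-mid : t (suc m) k ≈ (P / D₀) * ρ-mid
      t-mid = /-factor D₀≉0 d≉0 numerator denominator
        where
        d : Carrier
        d = 1-qᵐ⁺¹ * 1-axqᵐ⁺¹ * 1-ayqᵐ⁺¹ * 1-ayq²ᵐ⁺ᵏ⁺²
        d≉0 : d ≉ 0#
        d≉0 = *-≉0 (*-≉0 (*-≉0 1-qᵐ⁺¹≉0 1-axqᵐ⁺¹≉0) 1-ayqᵐ⁺¹≉0) 1-ayq²ᵐ⁺ᵏ⁺²≉0
        numerator : y ^ k * x ^ suc m * poch (x / y) q k * poch (y / x) q (suc m) * (1# - a * y * q ^ (suc m ℕ.+ suc m))
                    ≈ P * ((x - y) * 1-ayq²ᵐ⁺²)
        numerator = begin
          y ^ k * (x * x ^ m) * poch (x / y) q k * poch (y / x) q (suc m) * (1# - a * y * q ^ (suc m ℕ.+ suc m))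
            ≈⟨ *-cong (*-congˡ (poch-suc (y / x) m)) (1-‿cong (*-congˡ (^-homo-* q (suc m) (suc m)))) ⟩
          y ^ k * (x * x ^ m) * poch (x / y) q k * ((1# - y / x) * poch (y / x * q) q m) * 1-ayq²ᵐ⁺²
            ≈⟨ solve 7 (λ yᵏ x xᵐ X b B c → yᵏ :* (x :* xᵐ) :* X :* (b :* B) :* c := yᵏ :* xᵐ :* X :* B :* ((x :* b) :* c))
                       refl (y ^ k) x (x ^ m) (poch (x / y) q k) (1# - y / x) (poch (y / x * q) q m) 1-ayq²ᵐ⁺² ⟩
          P * ((x * (1# - y / x)) * 1-ayq²ᵐ⁺²)   ≈⟨ *-congˡ (*-congʳ (x*[1-y/x]≈x-y y x≉0)) ⟩
          P * ((x - y) * 1-ayq²ᵐ⁺²)              ∎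
        denominator : poch q q k * poch q q (suc m) * poch (a * x * q) q (suc m)
                      * poch (a * x * q ^ (suc m ℕ.+ suc m ℕ.+ k)) q k * poch (a * y * q ^ suc m) q (suc m ℕ.+ suc k)
                      ≈ D₀ * d
        denominator = begin
          poch q q k * (poch q q m * 1-qᵐ⁺¹) * (poch (a * x * q) q m * 1-axqᵐ⁺¹)
            * poch (a * x * q ^ (suc m ℕ.+ suc m ℕ.+ k)) q k
            * (poch (a * y * q ^ suc m) q (m ℕ.+ suc k) * (1# - a * y * q ^ suc m * q ^ (m ℕ.+ suc k)))
            ≈⟨ *-cong (*-congˡ (poch-cong k (*-congˡ (^-cong-≡ q (exponent m k)))))
                      (*-cong [ayqᵐ⁺¹]ₘ₊ₖ₊₁-split (1-‿cong (*-congˡ qᵐ⁺ᵏ⁺¹))) ⟩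
          poch q q k * (poch q q m * 1-qᵐ⁺¹) * (poch (a * x * q) q m * 1-axqᵐ⁺¹) * [axq²ᵐ⁺ᵏ⁺²]ₖ
            * ((1-ayqᵐ⁺¹ * [ayqᵐ⁺²]ₘ₊ₖ) * 1-ayq²ᵐ⁺ᵏ⁺²)
            ≈⟨ solve 9 (λ Qk Qm bM Xm bXm Xk bY Y bYn →
                          Qk :* (Qm :* bM) :* (Xm :* bXm) :* Xk :* ((bY :* Y) :* bYn)
                          := (Qk :* Qm :* Xm :* Xk :* Y) :* (bM :* bXm :* bY :* bYn))
                       refl (poch q q k) (poch q q m) 1-qᵐ⁺¹ (poch (a * x * q) q m) 1-axqᵐ⁺¹ [axq²ᵐ⁺ᵏ⁺²]ₖ
                            1-ayqᵐ⁺¹ [ayqᵐ⁺²]ₘ₊ₖ 1-ayq²ᵐ⁺ᵏ⁺² ⟩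
          D₀ * d ∎
          where
          exponent : ∀ m k → suc m ℕ.+ suc m ℕ.+ k ≡ suc m ℕ.+ k ℕ.+ suc m
          exponent = solve-∀

      G-right : G (suc m) k ≈ (P / D₀) * ρ-right
      G-right = /-factor D₀≉0 d≉0 numerator denominator
        where
        d : Carrier
        d = 1-axqᵐ⁺ᵏ⁺¹ * 1-qᵐ⁺ᵏ⁺¹ * 1-qᵐ⁺¹ * 1-axqᵐ⁺¹ * 1-ayq²ᵐ⁺ᵏ⁺²
        d≉0 : d ≉ 0#
        d≉0 = *-≉0 (*-≉0 (*-≉0 (*-≉0 1-axqᵐ⁺ᵏ⁺¹≉0 1-qᵐ⁺ᵏ⁺¹≉0) 1-qᵐ⁺¹≉0) 1-axqᵐ⁺¹≉0) 1-ayq²ᵐ⁺ᵏ⁺²≉0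
        numerator : y ^ k * x ^ suc m * poch (x / y) q k * poch (y / x * q) q (suc m) * (1# - q ^ k)
                    * (1# - a * x * q ^ (suc m ℕ.+ k ℕ.+ suc m))
                    ≈ P * ((x - y * (q * M)) * (1# - K) * 1-axq²ᵐ⁺ᵏ⁺²)
        numerator = begin
          y ^ k * (x * x ^ m) * poch (x / y) q k * (poch (y / x * q) q m * (1# - y / x * q * M)) * (1# - K)
            * (1# - a * x * q ^ (suc m ℕ.+ k ℕ.+ suc m))
            ≈⟨ *-congˡ (1-‿cong (*-congˡ (trans (^-homo-* q (suc m ℕ.+ k) (suc m)) (*-congʳ (*-congˡ (^-homo-* q m k)))))) ⟩
          y ^ k * (x * x ^ m) * poch (x / y) q k * (poch (y / x * q) q m * (1# - y / x * q * M)) * (1# - K)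
            * 1-axq²ᵐ⁺ᵏ⁺²
            ≈⟨ solve 8 (λ yᵏ x xᵐ X B b c e → yᵏ :* (x :* xᵐ) :* X :* (B :* b) :* c :* e
                                          := yᵏ :* xᵐ :* X :* B :* ((x :* b) :* c :* e))
                       refl (y ^ k) x (x ^ m) (poch (x / y) q k) (poch (y / x * q) q m) (1# - y / x * q * M) (1# - K) 1-axq²ᵐ⁺ᵏ⁺² ⟩
          P * ((x * (1# - y / x * q * M)) * (1# - K) * 1-axq²ᵐ⁺ᵏ⁺²)
            ≈⟨ *-congˡ (*-congʳ (*-congʳ (trans (*-congˡ (1-‿cong (*-assoc (y / x) q M))) (x*[1-y/x*z]≈x-y*z y (q * M) x≉0)))) ⟩
          P * ((x - y * (q * M)) * (1# - K) * 1-axq²ᵐ⁺ᵏ⁺²) ∎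
        denominator : (1# - a * x * q ^ (suc m ℕ.+ k)) * (1# - q ^ (suc m ℕ.+ k)) * poch q q k * poch q q (suc m)
                      * poch (a * x * q) q (suc m) * [axq²ᵐ⁺ᵏ⁺²]ₖ * poch (a * y * q ^ suc (suc m)) q (suc m ℕ.+ k)
                      ≈ D₀ * d
        denominator = begin
          (1# - a * x * q ^ (suc m ℕ.+ k)) * (1# - q ^ (suc m ℕ.+ k)) * poch q q k * (poch q q m * 1-qᵐ⁺¹)
            * (poch (a * x * q) q m * 1-axqᵐ⁺¹) * [axq²ᵐ⁺ᵏ⁺²]ₖ
            * ([ayqᵐ⁺²]ₘ₊ₖ * (1# - a * y * q ^ suc (suc m) * q ^ (m ℕ.+ k)))
            ≈⟨ *-cong (*-congʳ (*-congʳ (*-congʳ (*-congʳ (*-cong (1-‿cong (*-congˡ qᵐ⁺¹⁺ᵏ)) (1-‿cong qᵐ⁺¹⁺ᵏ))))))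
                      (*-congˡ (1-‿cong ayqᵐ⁺²qᵐ⁺ᵏ)) ⟩
          1-axqᵐ⁺ᵏ⁺¹ * 1-qᵐ⁺ᵏ⁺¹ * poch q q k * (poch q q m * 1-qᵐ⁺¹) * (poch (a * x * q) q m * 1-axqᵐ⁺¹)
            * [axq²ᵐ⁺ᵏ⁺²]ₖ * ([ayqᵐ⁺²]ₘ₊ₖ * 1-ayq²ᵐ⁺ᵏ⁺²)
            ≈⟨ solve 10 (λ bX bQ Qk Qm bM Xm bXm Xk Y bYn →
                           bX :* bQ :* Qk :* (Qm :* bM) :* (Xm :* bXm) :* Xk :* (Y :* bYn)
                           := (Qk :* Qm :* Xm :* Xk :* Y) :* (bX :* bQ :* bM :* bXm :* bYn))
                       refl 1-axqᵐ⁺ᵏ⁺¹ 1-qᵐ⁺ᵏ⁺¹ (poch q q k) (poch q q m) 1-qᵐ⁺¹ (poch (a * x * q) q m) 1-axqᵐ⁺¹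
                            [axq²ᵐ⁺ᵏ⁺²]ₖ [ayqᵐ⁺²]ₘ₊ₖ 1-ayq²ᵐ⁺ᵏ⁺² ⟩
          D₀ * d ∎

      rational-identity : ρ-left + ρ-mid ≈ ρ-right
      rational-identity = /-+-/-common D≉0
        (solve 6 (λ bX bQ bY bM bXm bYn → (bX :* bQ :* bY) :* (bM :* bXm :* bYn) := bX :* bQ :* bY :* bM :* bXm :* bYn)
               refl 1-axqᵐ⁺ᵏ⁺¹ 1-qᵐ⁺ᵏ⁺¹ 1-ayqᵐ⁺¹ 1-qᵐ⁺¹ 1-axqᵐ⁺¹ 1-ayq²ᵐ⁺ᵏ⁺²)
        (solve 6 (λ bX bQ bY bM bXm bYn → (bM :* bXm :* bY :* bYn) :* (bX :* bQ) := bX :* bQ :* bY :* bM :* bXm :* bYn)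
               refl 1-axqᵐ⁺ᵏ⁺¹ 1-qᵐ⁺ᵏ⁺¹ 1-ayqᵐ⁺¹ 1-qᵐ⁺¹ 1-axqᵐ⁺¹ 1-ayq²ᵐ⁺ᵏ⁺²)
        (solve 6 (λ bX bQ bY bM bXm bYn → (bX :* bQ :* bM :* bXm :* bYn) :* bY := bX :* bQ :* bY :* bM :* bXm :* bYn)
               refl 1-axqᵐ⁺ᵏ⁺¹ 1-qᵐ⁺ᵏ⁺¹ 1-ayqᵐ⁺¹ 1-qᵐ⁺¹ 1-axqᵐ⁺¹ 1-ayq²ᵐ⁺ᵏ⁺²)
        (telescoping-identity commutativeRing a x y q M K)
        where
        D≉0 : 1-axqᵐ⁺ᵏ⁺¹ * 1-qᵐ⁺ᵏ⁺¹ * 1-ayqᵐ⁺¹ * 1-qᵐ⁺¹ * 1-axqᵐ⁺¹ * 1-ayq²ᵐ⁺ᵏ⁺² ≉ 0#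
        D≉0 = *-≉0 (*-≉0 (*-≉0 (*-≉0 (*-≉0 1-axqᵐ⁺ᵏ⁺¹≉0 1-qᵐ⁺ᵏ⁺¹≉0) 1-ayqᵐ⁺¹≉0) 1-qᵐ⁺¹≉0) 1-axqᵐ⁺¹≉0)
                   1-ayq²ᵐ⁺ᵏ⁺²≉0

    step : ∀ m k → G m (suc k) + t (suc m) k ≈ G (suc m) k
    step m k = begin
      G m (suc k) + t (suc m) k              ≈⟨ +-cong G-left t-mid ⟩
      (P / D₀) * ρ-left + (P / D₀) * ρ-mid   ≈⟨ distribˡ (P / D₀) ρ-left ρ-mid ⟨
      (P / D₀) * (ρ-left + ρ-mid)            ≈⟨ *-congˡ rational-identity ⟩
      (P / D₀) * ρ-right                     ≈⟨ G-right ⟨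
      G (suc m) k                            ∎
      where open Step m k

    partial-sum : ∀ m k → sumTo m (λ j → t j (m ℕ.+ suc k ∸ j)) ≈ G m (suc k)
    partial-sum zero k = sym (G-base k)
    partial-sum (suc m) k = begin
      sumTo m (λ j → t j (suc m ℕ.+ suc k ∸ j)) + t (suc m) (m ℕ.+ suc k ∸ m)
        ≡⟨ ≡.cong₂ (λ n i → sumTo m (λ j → t j (n ∸ j)) + t (suc m) i)
                   (ℕ.+-suc m (suc k)) (≡.sym (ℕ.m+n∸m≡n m (suc k))) ⟨
      sumTo m (λ j → t j (m ℕ.+ suc (suc k) ∸ j)) + t (suc m) (suc k)
        ≈⟨ +-congʳ (partial-sum m (suc k)) ⟩
      G m (suc (suc k)) + t (suc m) (suc k)   ≈⟨ step m (suc k) ⟩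
      G (suc m) (suc k)                       ∎

    sum-t≈0 : ∀ n → sumTo (suc n) (λ j → t j (suc n ∸ j)) ≈ 0#
    sum-t≈0 n = begin
      sumTo n (λ j → t j (suc n ∸ j)) + t (suc n) (n ∸ n)
        ≡⟨ ≡.cong₂ (λ N i → sumTo n (λ j → t j (N ∸ j)) + t (suc n) i) (ℕ.+-comm 1 n) (ℕ.n∸n≡0 n) ⟩
      sumTo n (λ j → t j (n ℕ.+ 1 ∸ j)) + t (suc n) 0   ≈⟨ +-congʳ (partial-sum n 0) ⟩
      G n 1 + t (suc n) 0                              ≈⟨ step n 0 ⟩
      G (suc n) 0                                      ≈⟨ G-zero (suc n) ⟩
      0#                                               ∎

module _ {c ℓ} (F : Field c ℓ) where
  open Field F hiding (zero)
  open FieldOps F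

  M-even : ∀ q u v X Y r s i → r ℤ.- s ≡ + (i ℕ.+ i) → M q u v X Y r s ≡ entry q u v X Y r i
  M-even q u v X Y r s i r-s≡2i with r ℤ.- s | r-s≡2i
  ... | _ | ≡.refl rewrite half-even i = ≡.refl

  M-odd : ∀ q u v X Y r s i → r ℤ.- s ≡ + suc (i ℕ.+ i) → M q u v X Y r s ≡ 0#
  M-odd q u v X Y r s i r-s≡2i+1 with r ℤ.- s | r-s≡2i+1
  ... | _ | ≡.refl rewrite half-odd i = ≡.refl

  module MatrixProduct (q u v x y : Carrier) (p : ℤ) (q≉0 : q ≉ 0#) (x≉0 : x ≉ 0#) (y≉0 : y ≉ 0#)
    (1-qⁿ≉0 : ∀ (n : ℕ) → .{{NonZero n}} → ¬ ((1# - (q ^ n)) ≈ 0#))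
    (1-uxqⁿ≉0 : ∀ (n : ℤ) → ¬ ((1# - (u * (x * (q ^ᶻ n)))) ≈ 0#))
    (1-uyqⁿ≉0 : ∀ (n : ℤ) → ¬ ((1# - (u * (y * (q ^ᶻ n)))) ≈ 0#)) where
    open FieldProperties F
    open PowerProperties F
    open PochhammerProperties F q
    open SumProperties F
    open ℤ-CoefficientSolver commutativeRing
    open import Relation.Binary.Reasoning.Setoid setoid

    a : Carrier
    a = u * q ^ᶻ p

    open VanishingSum F a q x y using (t; sum-t≈0)

    uqᵖ⁺ᵉ≈aqᵉ : ∀ e → u * q ^ᶻ (p ℤ.+ + e) ≈ a * q ^ e
    uqᵖ⁺ᵉ≈aqᵉ e = trans (*-congˡ (^ᶻ-homo-* q≉0 p e)) (sym (*-assoc u (q ^ᶻ p) (q ^ e)))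

    uXqᵖ⁺ᵉ≈aXqᵉ : ∀ X e → u * (X * q ^ᶻ (p ℤ.+ + e)) ≈ a * X * q ^ e
    uXqᵖ⁺ᵉ≈aXqᵉ X e = begin
      u * (X * q ^ᶻ (p ℤ.+ + e))     ≈⟨ *-congˡ (*-congˡ (^ᶻ-homo-* q≉0 p e)) ⟩
      u * (X * (q ^ᶻ p * q ^ e))     ≈⟨ solve 4 (λ u X Q E → u :* (X :* (Q :* E)) := u :* Q :* X :* E)
                                              refl u X (q ^ᶻ p) (q ^ e) ⟩
      a * X * q ^ e                  ∎

    1-qⁿ⁺¹≉0 : ∀ n → 1# - q ^ suc n ≉ 0#
    1-qⁿ⁺¹≉0 n = 1-qⁿ≉0 (suc n)

    1-axqⁿ≉0 : ∀ n → 1# - a * x * q ^ n ≉ 0#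
    1-axqⁿ≉0 n = ≉0-resp-≈ (1-‿cong (uXqᵖ⁺ᵉ≈aXqᵉ x n)) (1-uxqⁿ≉0 (p ℤ.+ + n))

    1-ayqⁿ≉0 : ∀ n → 1# - a * y * q ^ n ≉ 0#
    1-ayqⁿ≉0 n = ≉0-resp-≈ (1-‿cong (uXqᵖ⁺ᵉ≈aXqᵉ y n)) (1-uyqⁿ≉0 (p ℤ.+ + n))

    entry-at : ∀ X Y c i → (∀ n → 1# - a * X * q ^ n ≉ 0#) → (∀ n → 1# - a * Y * q ^ n ≉ 0#) →
      entry q u v X Y (p ℤ.+ + (c ℕ.+ (i ℕ.+ i))) i
      ≈ Y ^ i * v ^ i * poch (X / Y) q i * poch (a * q ^ c) q (2 ℕ.* i)
        / (poch q q i * (poch (a * X * q ^ (c ℕ.+ i)) q i * poch (a * Y * q ^ suc c) q i))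
    entry-at X Y c i 1-aXqⁿ≉0 1-aYqⁿ≉0 = begin
      Y ^ i * v ^ i * (poch (X / Y) q i / poch q q i
        * (poch (u * q ^ᶻ (r ℤ.- + (2 ℕ.* i))) q (2 ℕ.* i)
           / (poch (u * (X * q ^ᶻ (r ℤ.- + i))) q i * poch (u * (Y * q ^ᶻ (r ℤ.- + (2 ℕ.* i) ℤ.+ + 1))) q i)))
        ≈⟨ *-congˡ (*-congˡ (/-cong (≉0-resp-≈ (sym Xᵢ*Yᵢ≈) Xᵢ*Yᵢ≉0) (poch-cong (2 ℕ.* i) uqʳ⁻²ⁱ≈) Xᵢ*Yᵢ≈)) ⟩
      Y ^ i * v ^ i * (poch (X / Y) q i / poch q q i * (poch (a * q ^ c) q (2 ℕ.* i) / Xᵢ*Yᵢ))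
        ≈⟨ *-congˡ (/-*-/ ([q]≉0 i) Xᵢ*Yᵢ≉0) ⟩
      Y ^ i * v ^ i * ((poch (X / Y) q i * poch (a * q ^ c) q (2 ℕ.* i)) / (poch q q i * Xᵢ*Yᵢ))
        ≈⟨ solve 4 (λ A B C D → A :* ((B :* C) :* D) := A :* B :* C :* D)
                   refl (Y ^ i * v ^ i) (poch (X / Y) q i) (poch (a * q ^ c) q (2 ℕ.* i)) ((poch q q i * Xᵢ*Yᵢ) ⁻¹) ⟩
      Y ^ i * v ^ i * poch (X / Y) q i * poch (a * q ^ c) q (2 ℕ.* i) / (poch q q i * Xᵢ*Yᵢ) ∎
      where
      r : ℤ
      r = p ℤ.+ + (c ℕ.+ (i ℕ.+ i))
      Xᵢ*Yᵢ : Carrier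
      Xᵢ*Yᵢ = poch (a * X * q ^ (c ℕ.+ i)) q i * poch (a * Y * q ^ suc c) q i
      [q]≉0 : ∀ n → poch q q n ≉ 0#
      [q]≉0 = poch-≉0 1-qⁿ⁺¹≉0
      Xᵢ*Yᵢ≉0 : Xᵢ*Yᵢ ≉ 0#
      Xᵢ*Yᵢ≉0 = *-≉0 (poch-≉0 (1-bqᵉqⁿ≉0 1-aXqⁿ≉0 (c ℕ.+ i)) i) (poch-≉0 (1-bqᵉqⁿ≉0 1-aYqⁿ≉0 (suc c)) i)
      r-2i≡p+c : ∀ z a b → z ℤ.+ (a ℤ.+ (b ℤ.+ b)) ℤ.- (b ℤ.+ (b ℤ.+ 0ℤ)) ≡ z ℤ.+ a
      r-2i≡p+c = ℤ-Solver.solve-∀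
      r-i≡p+c+i : ∀ z a b → z ℤ.+ (a ℤ.+ (b ℤ.+ b)) ℤ.- b ≡ z ℤ.+ (a ℤ.+ b)
      r-i≡p+c+i = ℤ-Solver.solve-∀
      r-2i+1≡p+1+c : ∀ z a b → z ℤ.+ (a ℤ.+ (b ℤ.+ b)) ℤ.- (b ℤ.+ (b ℤ.+ 0ℤ)) ℤ.+ 1ℤ ≡ z ℤ.+ (1ℤ ℤ.+ a)
      r-2i+1≡p+1+c = ℤ-Solver.solve-∀
      uqʳ⁻²ⁱ≈ : u * q ^ᶻ (r ℤ.- + (2 ℕ.* i)) ≈ a * q ^ c
      uqʳ⁻²ⁱ≈ = trans (reflexive (≡.cong (λ z → u * q ^ᶻ z) (r-2i≡p+c p (+ c) (+ i)))) (uqᵖ⁺ᵉ≈aqᵉ c)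
      Xᵢ*Yᵢ≈ : poch (u * (X * q ^ᶻ (r ℤ.- + i))) q i * poch (u * (Y * q ^ᶻ (r ℤ.- + (2 ℕ.* i) ℤ.+ + 1))) q i ≈ Xᵢ*Yᵢ
      Xᵢ*Yᵢ≈ = *-cong
        (poch-cong i (trans (reflexive (≡.cong (λ z → u * (X * q ^ᶻ z)) (r-i≡p+c+i p (+ c) (+ i))))
                            (uXqᵖ⁺ᵉ≈aXqᵉ X (c ℕ.+ i))))
        (poch-cong i (trans (reflexive (≡.cong (λ z → u * (Y * q ^ᶻ z)) (r-2i+1≡p+1+c p (+ c) (+ i))))
                            (uXqᵖ⁺ᵉ≈aXqᵉ Y (suc c))))

    [ayqʲ]ⱼ₊ᵢ₊₁-split : ∀ j i → poch (a * y * q ^ j) q (j ℕ.+ suc i)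
                        ≈ poch (a * y * q ^ j) q j * ((1# - a * y * q ^ (j ℕ.+ j)) * poch (a * y * q ^ suc (j ℕ.+ j)) q i)
    [ayqʲ]ⱼ₊ᵢ₊₁-split j i = begin
      poch (a * y * q ^ j) q (j ℕ.+ suc i)
        ≈⟨ poch-homo-* (a * y * q ^ j) j (suc i) ⟩
      poch (a * y * q ^ j) q j * poch (a * y * q ^ j * q ^ j) q (suc i)
        ≈⟨ *-congˡ (poch-cong (suc i) (*-^-homo-* (a * y) q j j)) ⟩
      poch (a * y * q ^ j) q j * poch (a * y * q ^ (j ℕ.+ j)) q (suc i)
        ≈⟨ *-congˡ (poch-suc (a * y * q ^ (j ℕ.+ j)) i) ⟩
      poch (a * y * q ^ j) q j * ((1# - a * y * q ^ (j ℕ.+ j)) * poch (a * y * q ^ (j ℕ.+ j) * q) q i)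
        ≈⟨ *-congˡ (*-congˡ (poch-cong i (bqᵉ*q≈bqᶠ (a * y) (j ℕ.+ j) ≡.refl))) ⟩
      poch (a * y * q ^ j) q j * ((1# - a * y * q ^ (j ℕ.+ j)) * poch (a * y * q ^ suc (j ℕ.+ j)) q i) ∎

    [a]₂₍ⱼ₊ᵢ₎-split : ∀ j i → poch a q (2 ℕ.* (j ℕ.+ i)) ≈ poch (a * q ^ 0) q (2 ℕ.* j) * poch (a * q ^ (j ℕ.+ j)) q (2 ℕ.* i)
    [a]₂₍ⱼ₊ᵢ₎-split j i = begin
      poch a q (2 ℕ.* (j ℕ.+ i))                          ≡⟨ ≡.cong (poch a q) (ℕ.*-distribˡ-+ 2 j i) ⟩
      poch a q (2 ℕ.* j ℕ.+ 2 ℕ.* i)                       ≈⟨ poch-homo-* a (2 ℕ.* j) (2 ℕ.* i) ⟩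
      poch a q (2 ℕ.* j) * poch (a * q ^ (2 ℕ.* j)) q (2 ℕ.* i)
        ≈⟨ *-cong (poch-cong (2 ℕ.* j) (sym (*-identityʳ a))) (poch-cong (2 ℕ.* i) (*-congˡ (^-cong-≡ q (2j≡j+j j)))) ⟩
      poch (a * q ^ 0) q (2 ℕ.* j) * poch (a * q ^ (j ℕ.+ j)) q (2 ℕ.* i) ∎
      where
      2j≡j+j : ∀ j → 2 ℕ.* j ≡ j ℕ.+ j
      2j≡j+j = solve-∀

    entry-product : ∀ j i → entry q u v x y (p ℤ.+ + (j ℕ.+ j ℕ.+ (i ℕ.+ i))) i * entry q u v y x (p ℤ.+ + (j ℕ.+ j)) j
                            ≈ v ^ (j ℕ.+ i) * poch a q (2 ℕ.* (j ℕ.+ i)) * t j i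
    entry-product j i = begin
      entry q u v x y (p ℤ.+ + (j ℕ.+ j ℕ.+ (i ℕ.+ i))) i * entry q u v y x (p ℤ.+ + (j ℕ.+ j)) j
        ≈⟨ *-cong (entry-at x y (j ℕ.+ j) i 1-axqⁿ≉0 1-ayqⁿ≉0) (entry-at y x 0 j 1-ayqⁿ≉0 1-axqⁿ≉0) ⟩
      (N₁ / D₁) * (N₂ / D₂)              ≈⟨ /-*-/ D₁≉0 D₂≉0 ⟩
      (N₁ * N₂) / (D₁ * D₂)              ≈⟨ /-reduce (*-≉0 D₁≉0 D₂≉0) B≉0 numerator denominator ⟨
      (C * Nₜ) / Dₜ                      ≈⟨ *-assoc C Nₜ (Dₜ ⁻¹) ⟩
      C * t j i                          ∎
      where
      N₁ N₂ D₁ D₂ B C Nₜ Dₜ : Carrier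
      N₁ = y ^ i * v ^ i * poch (x / y) q i * poch (a * q ^ (j ℕ.+ j)) q (2 ℕ.* i)
      D₁ = poch q q i * (poch (a * x * q ^ (j ℕ.+ j ℕ.+ i)) q i * poch (a * y * q ^ suc (j ℕ.+ j)) q i)
      N₂ = x ^ j * v ^ j * poch (y / x) q j * poch (a * q ^ 0) q (2 ℕ.* j)
      D₂ = poch q q j * (poch (a * y * q ^ j) q j * poch (a * x * q ^ 1) q j)
      B = 1# - a * y * q ^ (j ℕ.+ j)
      C = v ^ (j ℕ.+ i) * poch a q (2 ℕ.* (j ℕ.+ i))
      Nₜ = y ^ i * x ^ j * poch (x / y) q i * poch (y / x) q j * B
      Dₜ = poch q q i * poch q q j * poch (a * x * q) q j * poch (a * x * q ^ (j ℕ.+ j ℕ.+ i)) q i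
           * poch (a * y * q ^ j) q (j ℕ.+ suc i)
      D₁≉0 : D₁ ≉ 0#
      D₁≉0 = *-≉0 (poch-≉0 1-qⁿ⁺¹≉0 i)
                  (*-≉0 (poch-≉0 (1-bqᵉqⁿ≉0 1-axqⁿ≉0 (j ℕ.+ j ℕ.+ i)) i)
                        (poch-≉0 (1-bqᵉqⁿ≉0 1-ayqⁿ≉0 (suc (j ℕ.+ j))) i))
      D₂≉0 : D₂ ≉ 0#
      D₂≉0 = *-≉0 (poch-≉0 1-qⁿ⁺¹≉0 j)
                  (*-≉0 (poch-≉0 (1-bqᵉqⁿ≉0 1-ayqⁿ≉0 j) j) (poch-≉0 (1-bqᵉqⁿ≉0 1-axqⁿ≉0 1) j))
      B≉0 : B ≉ 0#
      B≉0 = 1-ayqⁿ≉0 (j ℕ.+ j)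
      numerator : C * Nₜ ≈ N₁ * N₂ * B
      numerator = begin
        v ^ (j ℕ.+ i) * poch a q (2 ℕ.* (j ℕ.+ i)) * Nₜ
          ≈⟨ *-congʳ (*-cong (^-homo-* v j i) ([a]₂₍ⱼ₊ᵢ₎-split j i)) ⟩
        v ^ j * v ^ i * (poch (a * q ^ 0) q (2 ℕ.* j) * poch (a * q ^ (j ℕ.+ j)) q (2 ℕ.* i)) * Nₜ
          ≈⟨ solve 9 (λ vʲ vⁱ Pⱼ Pᵢ yⁱ xʲ Xᵢ Yⱼ B →
                        vʲ :* vⁱ :* (Pⱼ :* Pᵢ) :* (yⁱ :* xʲ :* Xᵢ :* Yⱼ :* B)
                        := yⁱ :* vⁱ :* Xᵢ :* Pᵢ :* (xʲ :* vʲ :* Yⱼ :* Pⱼ) :* B)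
                     refl (v ^ j) (v ^ i) (poch (a * q ^ 0) q (2 ℕ.* j)) (poch (a * q ^ (j ℕ.+ j)) q (2 ℕ.* i))
                          (y ^ i) (x ^ j) (poch (x / y) q i) (poch (y / x) q j) B ⟩
        N₁ * N₂ * B ∎
      denominator : Dₜ ≈ D₁ * D₂ * B
      denominator = begin
        poch q q i * poch q q j * poch (a * x * q) q j * poch (a * x * q ^ (j ℕ.+ j ℕ.+ i)) q i
          * poch (a * y * q ^ j) q (j ℕ.+ suc i)
          ≈⟨ *-cong (*-congʳ (*-congˡ (poch-cong j (*-congˡ (sym (*-identityʳ q)))))) ([ayqʲ]ⱼ₊ᵢ₊₁-split j i) ⟩
        poch q q i * poch q q j * poch (a * x * q ^ 1) q j * poch (a * x * q ^ (j ℕ.+ j ℕ.+ i)) q i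
          * (poch (a * y * q ^ j) q j * (B * poch (a * y * q ^ suc (j ℕ.+ j)) q i))
          ≈⟨ solve 7 (λ Qᵢ Qⱼ Xⱼ Xᵢ Yⱼ B Yᵢ →
                        Qᵢ :* Qⱼ :* Xⱼ :* Xᵢ :* (Yⱼ :* (B :* Yᵢ)) := Qᵢ :* (Xᵢ :* Yᵢ) :* (Qⱼ :* (Yⱼ :* Xⱼ)) :* B)
                     refl (poch q q i) (poch q q j) (poch (a * x * q ^ 1) q j) (poch (a * x * q ^ (j ℕ.+ j ℕ.+ i)) q i)
                          (poch (a * y * q ^ j) q j) B (poch (a * y * q ^ suc (j ℕ.+ j)) q i) ⟩
        D₁ * D₂ * B ∎

    entry-zero : ∀ X Y r → entry q u v X Y r 0 ≈ 1#
    entry-zero X Y r = begin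
      1# * 1# * (1# * 1# ⁻¹ * (1# * (1# * 1#) ⁻¹))
        ≈⟨ *-congˡ (*-cong (*-congˡ 1⁻¹≈1) (*-congˡ (trans (⁻¹-cong 1*1≉0 1*1≈1) 1⁻¹≈1))) ⟩
      1# * 1# * (1# * 1# * (1# * 1#))
        ≈⟨ solve 0 (con (+ 1) :* con (+ 1) :* (con (+ 1) :* con (+ 1) :* (con (+ 1) :* con (+ 1)))
                    := con (+ 1)) refl ⟩
      1#                                            ∎
      where
      1*1≈1 : 1# * 1# ≈ 1#
      1*1≈1 = *-identityˡ 1#
      1*1≉0 : 1# * 1# ≉ 0#
      1*1≉0 = ≉0-resp-≈ (sym 1*1≈1) 1≉0

    summand : ℕ → ℕ → Carrier
    summand m k = M q u v x y (p ℤ.+ + m) (p ℤ.+ + k) * M q u v y x (p ℤ.+ + k) p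

    summand-even : ∀ j i → summand (j ℕ.+ i ℕ.+ (j ℕ.+ i)) (j ℕ.+ j)
                           ≈ v ^ (j ℕ.+ i) * poch a q (2 ℕ.* (j ℕ.+ i)) * t j i
    summand-even j i = trans (reflexive (≡.cong₂ _*_ first second)) (entry-product j i)
      where
      interchange : ∀ j i → j ℕ.+ i ℕ.+ (j ℕ.+ i) ≡ j ℕ.+ j ℕ.+ (i ℕ.+ i)
      interchange = solve-∀
      first : M q u v x y (p ℤ.+ + (j ℕ.+ i ℕ.+ (j ℕ.+ i))) (p ℤ.+ + (j ℕ.+ j))
              ≡ entry q u v x y (p ℤ.+ + (j ℕ.+ j ℕ.+ (i ℕ.+ i))) i
      first rewrite interchange j i =
        M-even q u v x y (p ℤ.+ + (j ℕ.+ j ℕ.+ (i ℕ.+ i))) (p ℤ.+ + (j ℕ.+ j)) i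
               (z+[a+b]-[z+a]≡b p (+ (j ℕ.+ j)) (+ (i ℕ.+ i)))
      second : M q u v y x (p ℤ.+ + (j ℕ.+ j)) p ≡ entry q u v y x (p ℤ.+ + (j ℕ.+ j)) j
      second = M-even q u v y x (p ℤ.+ + (j ℕ.+ j)) p j (z+a-z≡a p (+ (j ℕ.+ j)))

    summand-odd-column : ∀ m j → summand m (suc (j ℕ.+ j)) ≈ 0#
    summand-odd-column m j =
      trans (*-congˡ (reflexive (M-odd q u v y x (p ℤ.+ + suc (j ℕ.+ j)) p j (z+a-z≡a p (+ suc (j ℕ.+ j)))))) (zeroʳ _)

    summand-odd-row : ∀ k i → summand (k ℕ.+ suc (i ℕ.+ i)) k ≈ 0#
    summand-odd-row k i =
      trans (*-congʳ (reflexive (M-odd q u v x y (p ℤ.+ + (k ℕ.+ suc (i ℕ.+ i))) (p ℤ.+ + k) i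
                                       (z+[a+b]-[z+a]≡b p (+ k) (+ suc (i ℕ.+ i))))))
            (zeroˡ _)

    p+[1+n]≢p : ∀ n → p ℤ.+ + suc n ≢ p
    p+[1+n]≢p n p+[1+n]≡p
      with ≡.trans (≡.sym (z+a-z≡a p (+ suc n))) (≡.trans (≡.cong (ℤ._- p) p+[1+n]≡p) (ℤ.+-inverseʳ p))
    ... | ()

    even-sum : ∀ n → sumTo (n ℕ.+ n) (summand (n ℕ.+ n)) ≈ δ (p ℤ.+ + (n ℕ.+ n)) p
    even-sum zero = begin
      summand 0 0
        ≡⟨ ≡.cong₂ _*_ (M-even q u v x y (p ℤ.+ + 0) (p ℤ.+ + 0) 0 (z+[a+b]-[z+a]≡b p (+ 0) (+ 0)))
                       (M-even q u v y x (p ℤ.+ + 0) p 0 (z+a-z≡a p (+ 0))) ⟩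
      entry q u v x y (p ℤ.+ + 0) 0 * entry q u v y x (p ℤ.+ + 0) 0
        ≈⟨ trans (*-cong (entry-zero x y (p ℤ.+ + 0)) (entry-zero y x (p ℤ.+ + 0))) (*-identityˡ 1#) ⟩
      1#                                                 ≈⟨ δ-refl p ⟨
      δ p p                                              ≡⟨ ≡.cong (λ r → δ r p) (ℤ.+-identityʳ p) ⟨
      δ (p ℤ.+ + 0) p                                    ∎
    even-sum (suc n′) = begin
      sumTo (n ℕ.+ n) (summand (n ℕ.+ n))                 ≈⟨ sumTo-evens n (λ j _ → summand-odd-column (n ℕ.+ n) j) ⟩
      sumTo n (λ j → summand (n ℕ.+ n) (j ℕ.+ j))         ≈⟨ sumTo-cong n summand-at ⟩
      sumTo n (λ j → C * t j (n ∸ j))                     ≈⟨ sumTo-*-distribˡ n C (λ j → t j (n ∸ j)) ⟩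
      C * sumTo n (λ j → t j (n ∸ j))                     ≈⟨ *-congˡ (sum-t≈0 x≉0 y≉0 1-qⁿ⁺¹≉0 1-axqⁿ≉0 1-ayqⁿ≉0 n′) ⟩
      C * 0#                                              ≈⟨ zeroʳ C ⟩
      0#                                                  ≈⟨ δ-≢ (p+[1+n]≢p (n′ ℕ.+ n)) ⟨
      δ (p ℤ.+ + (n ℕ.+ n)) p                             ∎
      where
      n : ℕ
      n = suc n′
      C : Carrier
      C = v ^ n * poch a q (2 ℕ.* n)
      summand-at : ∀ j → j ℕ.≤ n → summand (n ℕ.+ n) (j ℕ.+ j) ≈ C * t j (n ∸ j)
      summand-at j j≤n = ≡.subst (λ N → summand (N ℕ.+ N) (j ℕ.+ j) ≈ v ^ N * poch a q (2 ℕ.* N) * t j (n ∸ j))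
                                 (ℕ.m+[n∸m]≡n j≤n) (summand-even j (n ∸ j))

    odd-sum : ∀ n → sumTo (suc (n ℕ.+ n)) (summand (suc (n ℕ.+ n))) ≈ δ (p ℤ.+ + suc (n ℕ.+ n)) p
    odd-sum n = trans (sumTo-≈0 (suc (n ℕ.+ n)) summand≈0) (sym (δ-≢ (p+[1+n]≢p (n ℕ.+ n))))
      where
      split : ∀ j i → j ℕ.+ j ℕ.+ suc (i ℕ.+ i) ≡ suc (j ℕ.+ i ℕ.+ (j ℕ.+ i))
      split = solve-∀
      summand≈0 : ∀ k → k ℕ.≤ suc (n ℕ.+ n) → summand (suc (n ℕ.+ n)) k ≈ 0#
      summand≈0 k k≤1+2n with halving k
      ... | odd j = summand-odd-column (suc (n ℕ.+ n)) j
      ... | even j = ≡.subst (λ N → summand (suc (N ℕ.+ N)) (j ℕ.+ j) ≈ 0#) (ℕ.m+[n∸m]≡n (j+j≤1+n+n⇒j≤n j n k≤1+2n))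
                       (≡.subst (λ m → summand m (j ℕ.+ j) ≈ 0#) (split j (n ∸ j)) (summand-odd-row (j ℕ.+ j) (n ∸ j)))

    product-sum : ∀ m → sumFromTo p (p ℤ.+ + m) (λ s → M q u v x y (p ℤ.+ + m) s * M q u v y x s p) ≈ δ (p ℤ.+ + m) p
    product-sum m rewrite z+a-z≡a p (+ m) with halving m
    ... | even n = even-sum n
    ... | odd n = odd-sum n

mainTheorem2 : ∀ {c ℓ : Level} (F : Field c ℓ) →
  let open Field F
      open FieldOps F
  in (q u v x y : Carrier) →
     -- genericity of the parameters (all denominators are nonzero)
     ¬ (q ≈ 0#) → ¬ (x ≈ 0#) → ¬ (y ≈ 0#) →
     (∀ (n : ℕ) → .{{NonZero n}} → ¬ ((1# - (q ^ n)) ≈ 0#)) →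
     (∀ (n : ℤ) → ¬ ((1# - (u * (x * (q ^ᶻ n)))) ≈ 0#)) →
     (∀ (n : ℤ) → ¬ ((1# - (u * (y * (q ^ᶻ n)))) ≈ 0#)) →
     ∀ (r p : ℤ) → p ≤ r →
     sumFromTo p r (λ s → M q u v x y r s * M q u v y x s p) ≈ δ r p
mainTheorem2 F q u v x y q≉0 x≉0 y≉0 1-qⁿ≉0 1-uxqⁿ≉0 1-uyqⁿ≉0 r p p≤r =
  ≡.subst (λ r → sumFromTo p r (λ s → M q u v x y r s * M q u v y x s p) ≈ δ r p) p+∣r-p∣≡r (product-sum ∣ r ℤ.- p ∣)
  where
  open Field F
  open FieldOps F
  open MatrixProduct F q u v x y p q≉0 x≉0 y≉0 1-qⁿ≉0 1-uxqⁿ≉0 1-uyqⁿ≉0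
  z+[a-z]≡a : ∀ z a → z ℤ.+ (a ℤ.- z) ≡ a
  z+[a-z]≡a = ℤ-Solver.solve-∀
  p+∣r-p∣≡r : p ℤ.+ + ∣ r ℤ.- p ∣ ≡ r
  p+∣r-p∣≡r = ≡.trans (≡.cong (λ w → p ℤ.+ w) (ℤ.0≤i⇒+∣i∣≡i (ℤ.i≤j⇒0≤j-i p≤r))) (z+[a-z]≡a p r)
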